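{- For $w,u\in\widehat{\mathfrak{H}}^{0}$ we have \begin{align*} \zeta_{q}(w)\zeta_{q}(u)=\zeta_{q}(w\mathbin{\sqcup\!\sqcup}_q u). \end{align*} In particular, the map $\zeta_q$ is a $\mathcal{C}$-algebra homomorphism from $\widehat{\mathfrak{H}}^{0}$ to $\mathbb{Q}[[q]]$.
   Context: Let $\mathcal{C}=\mathbb{Q}[\hbar,\hbar^{ -1}]$, $\widehat{\mathfrak{H}}=\mathcal{C}\langle a,b\rangle$, $\widehat{\mathfrak{H}}^0=\mathcal{C}+a\widehat{\mathfrak{H}}b$, $e_k=a^kb$. $\mathbb{Q}[[q]]$ is a $\mathcal{C}$-algebra with $\hbar$ acting as multiplication by $1-q$; $[m]_q=(1-q^m)/(1-q)$. The $\mathcal{C}$-linear map $\zeta_q:\widehat{\mathfrak{H}}^0\to\mathbb{Q}[[q]]$ sends $e_{k_1}\cdots e_{k_r}$ to $\zeta_q(k_1,\dots,k_r)=\sum_{m_1>\cdots>m_r>0}\prod_{j=1}^r\frac{q^{k_jm_j}}{[m_j]_q^{k_j}}$ and ${\bf 1}$ to $1$. The $q$-shuffle product $\mathbin{\sqcup\!\sqcup}_q$ is defined for letters $\alpha,\beta\in\{a,b\}$ and words $w,v$ by $\alpha w\mathbin{\sqcup\!\sqcup}_q\beta v=\alpha(w\mathbin{\sqcup\!\sqcup}_q\beta v)+\beta(\alpha w\mathbin{\sqcup\!\sqcup}_q v)+(\alpha\diamond_q\beta)(w\mathbin{\sqcup\!\sqcup}_q v)$, ${\bf 1}$ being the unit,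 where $a\diamond_qb=b\diamond_qa=-ab$, $b\diamond_qb=-bb$, $a\diamond_qa=\hbar a$. -}

module Defs where

open import Data.Nat as ℕ using (ℕ; zero; suc; _∸_; _≟_)
open import Data.Nat.DivMod using (_%_)
open import Data.Integer as ℤ using (ℤ; +_; -[1+_])
open import Data.Rational as ℚ using (ℚ; 0ℚ; 1ℚ; _+_; _*_; -_)
open import Data.List using (List; []; _∷_; _++_; map; concatMap; [_])
open import Data.List.Relation.Unary.All using (All)
open import Data.Product using (_×_; _,_; ∃)
open import Data.Sum using (_⊎_)
open import Relation.Binary.PropositionalEquality using (_≡_)
open import Relation.Nullary.Decidable using (does)
open import Data.Bool using (if_then_else_)

Series : Set
Series = ℕ → ℚ

sumBelow : ℕ → (ℕ → ℚ) → ℚ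
sumBelow zero    f = 0ℚ
sumBelow (suc n) f = sumBelow n f + f n

_⊕_ : Series → Series → Series
(f ⊕ g) n = f n + g n

_⊛_ : Series → Series → Series
(f ⊛ g) n = sumBelow (suc n) (λ i → f i * g (n ∸ i))

zeroS : Series
zeroS _ = 0ℚ

scaleS : ℚ → Series → Series
scaleS c f n = c * f n

qPow : ℕ → Series
qPow m n = if does (n ≟ m) then 1ℚ else 0ℚ

oneS : Series
oneS = qPow 0

powS : Series → ℕ → Series
powS f zero    = oneS
powS f (suc k) = f ⊛ powS f k

oneMinusQ : Series
oneMinusQ zero          = 1ℚ
oneMinusQ (suc zero)    = - 1ℚ
oneMinusQ (suc (suc _)) = 0ℚ

-- 1/(1 - q^(m+1)) = Σ_j q^((m+1) j)
geomS : ℕ → Series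
geomS m n = if does ((n % suc m) ≟ 0) then 1ℚ else 0ℚ

-- q^(k m) / [m]_q^k  for m = suc m', written as q^(k m) (1-q)^k (1/(1-q^m))^k
termS : ℕ → ℕ → Series
termS k m' = qPow (k ℕ.* suc m') ⊛ (powS oneMinusQ k ⊛ powS (geomS m') k)

-- The coefficient ring C = Q[ħ, ħ⁻¹] as finite lists of (exponent, coeff)

C : Set
C = List (ℤ × ℚ)

oneC : C
oneC = (+ 0 , 1ℚ) ∷ []

_·C_ : C → C → C
c ·C d = concatMap (λ { (e , x) → map (λ { (e' , y) → (e ℤ.+ e' , x * y) }) d }) c

-- action of ħ^e on Q[[q]]: ħ = 1 - q, ħ⁻¹ = 1/(1-q)
hbarPow : ℤ → Series
hbarPow (+ n)      = powS oneMinusQ n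
hbarPow -[1+ n ]   = powS (geomS 0) (suc n)

actC : C → Series
actC []             = zeroS
actC ((e , x) ∷ c)  = scaleS x (hbarPow e) ⊕ actC c

-- Words and the algebra Ĥ = C⟨a,b⟩ (finite C-linear combinations of words)

data Letter : Set where
  a b : Letter

Word : Set
Word = List Letter

H : Set
H = List (C × Word)

-- indices (k₁,…,k_r) of a word e_{k₁}⋯e_{k_r}, e_k = a^k b
-- (trailing a's, which do not occur for words of Ĥ⁰, are discarded)
indicesFrom : ℕ → Word → List ℕ
indicesFrom n []      = []
indicesFrom n (a ∷ w) = indicesFrom (suc n) w
indicesFrom n (b ∷ w) = n ∷ indicesFrom 0 w

indices : Word → List ℕ
indices = indicesFrom 0

-- partial sums Σ_{B > m₁ > ⋯ > m_r > 0} Π q^{k_j m_j}/[m_j]^{k_j}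
-- (m = suc m' ranges over 1 ≤ m < B, i.e. m' < B ∸ 1)
nestedSum : List ℕ → ℕ → Series
nestedSum []       B = oneS
nestedSum (k ∷ ks) B n =
  sumBelow (B ∸ 1) (λ m' → (termS k m' ⊛ nestedSum ks (suc m')) n)

-- ζ_q(k₁,…,k_r): the coefficient of q^N only involves m₁ ≤ N (each term is
-- O(q^{k₁ m₁}) with k₁ ≥ 1), so it equals the coefficient of the partial sum
-- over m₁ < N+1.  The empty word gives 1.
ζqWord : Word → Series
ζqWord w N = nestedSum (indices w) (suc N) N

ζq : H → Series
ζq []             = zeroS
ζq ((c , w) ∷ h)  = (actC c ⊛ ζqWord w) ⊕ ζq h

WordInH0 : Word → Set
WordInH0 w = (w ≡ []) ⊎ ∃ (λ v → w ≡ a ∷ (v ++ [ b ]))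

InH0 : H → Set
InH0 h = All (λ t → WordInH0 (Data.Product.proj₂ t)) h

mulLeft : C → Word → H → H
mulLeft c x = map (λ { (d , w) → (c ·C d , x ++ w) })

diamondC : Letter → Letter → C
diamondC a a = (+ 1 , 1ℚ) ∷ []
diamondC _ _ = (+ 0 , - 1ℚ) ∷ []

diamondW : Letter → Letter → Word
diamondW a a = a ∷ []
diamondW b b = b ∷ b ∷ []
diamondW _ _ = a ∷ b ∷ []

shuffleW : Word → Word → H
shuffleW []        v          = (oneC , v) ∷ []
shuffleW w@(_ ∷ _) []         = (oneC , w) ∷ []
shuffleW (α ∷ w)   (β ∷ v)    =
  mulLeft oneC (α ∷ []) (shuffleW w (β ∷ v))
  ++ mulLeft oneC (β ∷ []) (shuffleW (α ∷ w) v)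
  ++ mulLeft (diamondC α β) (diamondW α β) (shuffleW w v)

shuffleq : H → H → H
shuffleq h k =
  concatMap (λ { (c , w) → concatMap (λ { (d , v) →
    map (λ { (e , x) → ((c ·C d) ·C e , x) }) (shuffleW w v) }) k }) h

-- Write ħ = 1 - q and y M = q^M / (1 - q^M), so that q^{k m} / [m]_q^k = (ħ y m)^k.  Fix a
-- cut-off L and read a word from the left as an operator on families of series indexed by
-- X : ℕ, the letter a acting as ħ Σ_{X<Y<L} and b as multiplication by y X; applied to the
-- constant 1 at X = 0 it yields a finite iterated sum.  Expanding y P = Σ_{j≥1} q^{P j} and
-- exchanging summations shows that for w ∈ Ĥ⁰ this iterated sum agrees with ζ_q(w) up to
-- q^{L-1}.
-- The sums R f X = Σ_{X<Y<L} f Y satisfy the Rota–Baxter identity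
-- R f · R g = R (f · R g) + R (R f · g) + R (f · g) exactly, and multiplication by y X
-- commutes with everything.  By induction on words the iterated sums therefore turn the
-- q-shuffle into the product: for a a the three terms of the identity are the three terms of
-- the recursion, a ⋄ a = ħ a supplying the second factor ħ, and in the other cases the
-- ⋄-term cancels one of the other two.  The theorem follows by C-bilinearity, comparing
-- coefficients of q^N with L = N + 1.

module Submission where

open import Defs
open import Data.Nat.DivMod using (m≤n⇒m%n≡m; [m+n]%n≡m%n)
open import Data.Nat as ℕ using (ℕ; zero; suc; _∸_; _≤_; _<_; z≤n; s≤s; _≟_; _<?_)
import Data.Nat.Properties as ℕP
open import Data.Integer as ℤ using (-[1+_]; _⊖_)
import Data.Integer.Properties as ℤP
open import Data.Rational as ℚ using (ℚ; 0ℚ; 1ℚ; _+_; _*_; -_)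
import Data.Rational.Properties as ℚP
open import Data.Rational.Solver using (module +-*-Solver)
open import Data.Product using (_×_; _,_; proj₁; proj₂)
open import Data.List using (List; []; _∷_; _++_; [_]; map; concatMap)
open import Data.List.Relation.Unary.All as All using (All; []; _∷_)
open import Data.List.Relation.Unary.All.Properties using (map⁺; ++⁺; concat⁺)
open import Data.Sum using (_⊎_; inj₁; inj₂)
open import Data.Empty using (⊥; ⊥-elim)
open import Data.Unit using (⊤; tt)
open import Data.Bool using (true; false; if_then_else_)
open import Relation.Binary.PropositionalEquality using (_≡_; _≢_; refl; sym; trans; cong; cong₂; subst; module ≡-Reasoning)
open import Relation.Nullary using (Dec; yes; no; ¬_)
open import Relation.Nullary.Decidable using (does; dec-true; dec-false)
open import Function using (_∘_; case_of_)
open import Algebra.Bundles using (CommutativeRing)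
open import Relation.Binary.Bundles using (Setoid)
open import Algebra.Structures using (IsCommutativeRing)
import Algebra.Properties.Ring as RingProperties
import Algebra.Solver.Ring.NaturalCoefficients.Default
import Relation.Binary.Reasoning.Setoid as SetoidReasoning

sumBelow-cong-< : ∀ n {f g : ℕ → ℚ} → (∀ i → i < n → f i ≡ g i) → sumBelow n f ≡ sumBelow n g
sumBelow-cong-< zero    f≡g = refl
sumBelow-cong-< (suc n) f≡g =
  cong₂ _+_ (sumBelow-cong-< n (λ i i<n → f≡g i (ℕP.m<n⇒m<1+n i<n))) (f≡g n (ℕP.n<1+n n))

sumBelow-cong : ∀ n {f g : ℕ → ℚ} → (∀ i → f i ≡ g i) → sumBelow n f ≡ sumBelow n g
sumBelow-cong n f≡g = sumBelow-cong-< n (λ i _ → f≡g i)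

sumBelow-vanish : ∀ n {f : ℕ → ℚ} → (∀ i → i < n → f i ≡ 0ℚ) → sumBelow n f ≡ 0ℚ
sumBelow-vanish zero    f≡0 = refl
sumBelow-vanish (suc n) f≡0 = begin
  sumBelow n _ + _ ≡⟨ cong₂ _+_ (sumBelow-vanish n (λ i i<n → f≡0 i (ℕP.m<n⇒m<1+n i<n))) (f≡0 n (ℕP.n<1+n n)) ⟩
  0ℚ + 0ℚ          ≡⟨ ℚP.+-identityʳ 0ℚ ⟩
  0ℚ               ∎
  where open ≡-Reasoning

sumBelow-+ : ∀ n (f g : ℕ → ℚ) → sumBelow n (λ i → f i + g i) ≡ sumBelow n f + sumBelow n g
sumBelow-+ zero    f g = sym (ℚP.+-identityʳ 0ℚ)
sumBelow-+ (suc n) f g = trans (cong (_+ (f n + g n)) (sumBelow-+ n f g))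
                               (interchange (sumBelow n f) (sumBelow n g) (f n) (g n))
  where
  open +-*-Solver
  interchange : ∀ a b c d → (a + b) + (c + d) ≡ (a + c) + (b + d)
  interchange = solve 4 (λ a b c d → (a :+ b) :+ (c :+ d) := (a :+ c) :+ (b :+ d)) refl

*-distribˡ-sumBelow : ∀ n c (f : ℕ → ℚ) → c * sumBelow n f ≡ sumBelow n (λ i → c * f i)
*-distribˡ-sumBelow zero    c f = ℚP.*-zeroʳ c
*-distribˡ-sumBelow (suc n) c f =
  trans (ℚP.*-distribˡ-+ c _ _) (cong (_+ (c * f n)) (*-distribˡ-sumBelow n c f))

*-distribʳ-sumBelow : ∀ n c (f : ℕ → ℚ) → sumBelow n f * c ≡ sumBelow n (λ i → f i * c)
*-distribʳ-sumBelow n c f = begin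
  sumBelow n f * c              ≡⟨ ℚP.*-comm _ c ⟩
  c * sumBelow n f              ≡⟨ *-distribˡ-sumBelow n c f ⟩
  sumBelow n (λ i → c * f i)    ≡⟨ sumBelow-cong n (λ i → ℚP.*-comm c (f i)) ⟩
  sumBelow n (λ i → f i * c)    ∎
  where open ≡-Reasoning

sumBelow-sucˡ : ∀ n (f : ℕ → ℚ) → sumBelow (suc n) f ≡ f 0 + sumBelow n (λ i → f (suc i))
sumBelow-sucˡ zero    f = trans (ℚP.+-identityˡ (f 0)) (sym (ℚP.+-identityʳ (f 0)))
sumBelow-sucˡ (suc n) f = begin
  sumBelow (suc n) f + f (suc n)                    ≡⟨ cong (_+ f (suc n)) (sumBelow-sucˡ n f) ⟩
  (f 0 + sumBelow n (λ i → f (suc i))) + f (suc n)  ≡⟨ ℚP.+-assoc (f 0) _ (f (suc n)) ⟩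
  f 0 + (sumBelow n (λ i → f (suc i)) + f (suc n))  ∎
  where open ≡-Reasoning

sumBelow-reverse : ∀ n (f : ℕ → ℚ) → sumBelow (suc n) f ≡ sumBelow (suc n) (λ i → f (n ∸ i))
sumBelow-reverse zero    f = refl
sumBelow-reverse (suc n) f = begin
  sumBelow (suc (suc n)) f                              ≡⟨ sumBelow-sucˡ (suc n) f ⟩
  f 0 + sumBelow (suc n) (λ i → f (suc i))              ≡⟨ cong (f 0 +_) (sumBelow-reverse n (λ i → f (suc i))) ⟩
  f 0 + sumBelow (suc n) (λ i → f (suc (n ∸ i)))        ≡⟨ ℚP.+-comm (f 0) _ ⟩
  sumBelow (suc n) (λ i → f (suc (n ∸ i))) + f 0        ≡⟨ cong₂ _+_ (sumBelow-cong-< (suc n) (λ i i<sn →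
                                                             cong f (sym (ℕP.+-∸-assoc 1 (ℕP.<⇒≤pred i<sn)))))
                                                           (cong f (sym (ℕP.n∸n≡0 (suc n)))) ⟩
  sumBelow (suc n) (λ i → f (suc n ∸ i)) + f (suc n ∸ suc n) ∎
  where open ≡-Reasoning

sumBelow-swap : ∀ n m (F : ℕ → ℕ → ℚ) →
  sumBelow n (λ i → sumBelow m (F i)) ≡ sumBelow m (λ j → sumBelow n (λ i → F i j))
sumBelow-swap zero    m F = sym (sumBelow-vanish m (λ _ _ → refl))
sumBelow-swap (suc n) m F = begin
  sumBelow n (λ i → sumBelow m (F i)) + sumBelow m (F n)           ≡⟨ cong (_+ sumBelow m (F n)) (sumBelow-swap n m F) ⟩
  sumBelow m (λ j → sumBelow n (λ i → F i j)) + sumBelow m (F n)   ≡⟨ sym (sumBelow-+ m _ _) ⟩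
  sumBelow m (λ j → sumBelow (suc n) (λ i → F i j))                ∎
  where open ≡-Reasoning

sumBelow-triangle : ∀ n (F : ℕ → ℕ → ℚ) →
  sumBelow (suc n) (λ k → sumBelow (suc k) (λ i → F i k)) ≡
  sumBelow (suc n) (λ i → sumBelow (suc (n ∸ i)) (λ j → F i (i ℕ.+ j)))
sumBelow-triangle zero    F = refl
sumBelow-triangle (suc n) F = begin
  Tri n + sumBelow (suc (suc n)) (λ i → F i (suc n))
    ≡⟨ cong (_+ sumBelow (suc (suc n)) (λ i → F i (suc n))) (sumBelow-triangle n F) ⟩
  Rows n + (sumBelow (suc n) (λ i → F i (suc n)) + F (suc n) (suc n))
    ≡⟨ sym (ℚP.+-assoc (Rows n) _ _) ⟩
  (Rows n + sumBelow (suc n) (λ i → F i (suc n))) + F (suc n) (suc n)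
    ≡⟨ cong₂ _+_ (sym (sumBelow-+ (suc n) _ _)) lastRow ⟩
  sumBelow (suc n) (λ i → Row n i + F i (suc n)) + Row (suc n) (suc n)
    ≡⟨ cong (_+ Row (suc n) (suc n)) (sumBelow-cong-< (suc n) (λ i i<sn → extendRow i (ℕP.<⇒≤pred i<sn))) ⟩
  Rows (suc n) ∎
  where
  open ≡-Reasoning
  Tri : ℕ → ℚ
  Tri m = sumBelow (suc m) (λ k → sumBelow (suc k) (λ i → F i k))
  Row : ℕ → ℕ → ℚ
  Row m i = sumBelow (suc (m ∸ i)) (λ j → F i (i ℕ.+ j))
  Rows : ℕ → ℚ
  Rows m = sumBelow (suc m) (Row m)

  lastRow : F (suc n) (suc n) ≡ Row (suc n) (suc n)
  lastRow = begin
    F (suc n) (suc n)                ≡⟨ cong (F (suc n)) (sym (ℕP.+-identityʳ (suc n))) ⟩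
    F (suc n) (suc n ℕ.+ 0)          ≡⟨ sym (ℚP.+-identityˡ _) ⟩
    sumBelow 1 (λ j → F (suc n) (suc n ℕ.+ j))
      ≡⟨ cong (λ k → sumBelow (suc k) (λ j → F (suc n) (suc n ℕ.+ j))) (sym (ℕP.n∸n≡0 n)) ⟩
    Row (suc n) (suc n)              ∎

  extendRow : ∀ i → i ≤ n → Row n i + F i (suc n) ≡ Row (suc n) i
  extendRow i i≤n = begin
    Row n i + F i (suc n)
      ≡⟨ cong (λ k → Row n i + F i k) (sym (trans (ℕP.+-suc i (n ∸ i)) (cong suc (ℕP.m+[n∸m]≡n i≤n)))) ⟩
    sumBelow (suc (suc (n ∸ i))) (λ j → F i (i ℕ.+ j))
      ≡⟨ cong (λ k → sumBelow (suc k) (λ j → F i (i ℕ.+ j))) (sym (ℕP.+-∸-assoc 1 i≤n)) ⟩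
    Row (suc n) i ∎

infix 4 _≈_
_≈_ : Series → Series → Set
f ≈ g = ∀ n → f n ≡ g n

negS : Series → Series
negS f n = - f n

⊛-comm : ∀ f g → (f ⊛ g) ≈ (g ⊛ f)
⊛-comm f g n = begin
  sumBelow (suc n) (λ i → f i * g (n ∸ i))              ≡⟨ sumBelow-reverse n _ ⟩
  sumBelow (suc n) (λ i → f (n ∸ i) * g (n ∸ (n ∸ i)))  ≡⟨ sumBelow-cong-< (suc n) (λ i i<sn →
    trans (cong (λ k → f (n ∸ i) * g k) (ℕP.m∸[m∸n]≡n (ℕP.<⇒≤pred i<sn))) (ℚP.*-comm (f (n ∸ i)) (g i))) ⟩
  sumBelow (suc n) (λ i → g i * f (n ∸ i))              ∎
  where open ≡-Reasoning

⊛-assoc : ∀ f g h → ((f ⊛ g) ⊛ h) ≈ (f ⊛ (g ⊛ h))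
⊛-assoc f g h n = begin
  sumBelow (suc n) (λ k → sumBelow (suc k) (λ i → f i * g (k ∸ i)) * h (n ∸ k))
    ≡⟨ sumBelow-cong (suc n) (λ k → *-distribʳ-sumBelow (suc k) (h (n ∸ k)) _) ⟩
  sumBelow (suc n) (λ k → sumBelow (suc k) (λ i → f i * g (k ∸ i) * h (n ∸ k)))
    ≡⟨ sumBelow-triangle n (λ i k → f i * g (k ∸ i) * h (n ∸ k)) ⟩
  sumBelow (suc n) (λ i → sumBelow (suc (n ∸ i)) (λ j → f i * g (i ℕ.+ j ∸ i) * h (n ∸ (i ℕ.+ j))))
    ≡⟨ sumBelow-cong (suc n) (λ i → sumBelow-cong (suc (n ∸ i)) (λ j →
         trans (cong₂ (λ k l → f i * g k * h l) (ℕP.m+n∸m≡n i j) (sym (ℕP.∸-+-assoc n i j)))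
               (ℚP.*-assoc (f i) (g j) (h (n ∸ i ∸ j))))) ⟩
  sumBelow (suc n) (λ i → sumBelow (suc (n ∸ i)) (λ j → f i * (g j * h (n ∸ i ∸ j))))
    ≡⟨ sumBelow-cong (suc n) (λ i → sym (*-distribˡ-sumBelow (suc (n ∸ i)) (f i) _)) ⟩
  sumBelow (suc n) (λ i → f i * sumBelow (suc (n ∸ i)) (λ j → g j * h (n ∸ i ∸ j))) ∎
  where open ≡-Reasoning

⊛-identityˡ : ∀ f → (oneS ⊛ f) ≈ f
⊛-identityˡ f n = begin
  sumBelow (suc n) (λ i → oneS i * f (n ∸ i))       ≡⟨ sumBelow-sucˡ n _ ⟩
  1ℚ * f n + sumBelow n (λ i → 0ℚ * f (n ∸ suc i))  ≡⟨ cong₂ _+_ (ℚP.*-identityˡ (f n))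
                                                         (sumBelow-vanish n (λ i _ → ℚP.*-zeroˡ (f (n ∸ suc i)))) ⟩
  f n + 0ℚ                                          ≡⟨ ℚP.+-identityʳ (f n) ⟩
  f n                                               ∎
  where open ≡-Reasoning

⊛-distribˡ : ∀ f g h → (f ⊛ (g ⊕ h)) ≈ ((f ⊛ g) ⊕ (f ⊛ h))
⊛-distribˡ f g h n = trans (sumBelow-cong (suc n) (λ i → ℚP.*-distribˡ-+ (f i) _ _)) (sumBelow-+ (suc n) _ _)

⊛-cong : ∀ {f f' g g'} → f ≈ f' → g ≈ g' → (f ⊛ g) ≈ (f' ⊛ g')
⊛-cong f≈f' g≈g' n = sumBelow-cong (suc n) (λ i → cong₂ _*_ (f≈f' i) (g≈g' (n ∸ i)))

seriesCommutativeRing : CommutativeRing _ _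
seriesCommutativeRing = record { isCommutativeRing = isCommutativeRing }
  where
  isCommutativeRing : IsCommutativeRing _≈_ _⊕_ _⊛_ negS zeroS oneS
  isCommutativeRing = record
    { isRing = record
      { +-isAbelianGroup = record
        { isGroup = record
          { isMonoid = record
            { isSemigroup = record
              { isMagma = record
                { isEquivalence = record { refl = λ _ → refl ; sym = λ p n → sym (p n) ; trans = λ p q n → trans (p n) (q n) }
                ; ∙-cong = λ p q n → cong₂ _+_ (p n) (q n) }
              ; assoc = λ f g h n → ℚP.+-assoc (f n) (g n) (h n) }
            ; identity = (λ f n → ℚP.+-identityˡ (f n)) , (λ f n → ℚP.+-identityʳ (f n)) }
          ; inverse = (λ f n → ℚP.+-inverseˡ (f n)) , (λ f n → ℚP.+-inverseʳ (f n))
          ; ⁻¹-cong = λ p n → cong -_ (p n) }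
        ; comm = λ f g n → ℚP.+-comm (f n) (g n) }
      ; *-cong = ⊛-cong
      ; *-assoc = ⊛-assoc
      ; *-identity = ⊛-identityˡ , λ f → λ n → trans (⊛-comm f oneS n) (⊛-identityˡ f n)
      ; distrib = ⊛-distribˡ , λ f g h n → trans (⊛-comm (g ⊕ h) f n)
                                 (trans (⊛-distribˡ f g h n) (cong₂ _+_ (⊛-comm f g n) (⊛-comm f h n))) }
    ; *-comm = ⊛-comm }

open CommutativeRing seriesCommutativeRing
  using ()
  renaming ( refl to ≈-refl; sym to ≈-sym; trans to ≈-trans; +-cong to ⊕-cong
           ; *-identityʳ to ⊛-identityʳ; distribʳ to ⊛-distribʳ; zeroˡ to ⊛-zeroˡ; zeroʳ to ⊛-zeroʳ)

open RingProperties (CommutativeRing.ring seriesCommutativeRing) using (-‿distribˡ-*)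

⊕-congˡ : ∀ f {g g'} → g ≈ g' → (f ⊕ g) ≈ (f ⊕ g')
⊕-congˡ f g≈g' n = cong (f n +_) (g≈g' n)

⊕-congʳ : ∀ g {f f'} → f ≈ f' → (f ⊕ g) ≈ (f' ⊕ g)
⊕-congʳ g f≈f' n = cong (_+ g n) (f≈f' n)

⊛-congˡ : ∀ f {g g'} → g ≈ g' → (f ⊛ g) ≈ (f ⊛ g')
⊛-congˡ f = ⊛-cong {f} {f} (λ _ → refl)

⊛-congʳ : ∀ g {f f'} → f ≈ f' → (f ⊛ g) ≈ (f' ⊛ g)
⊛-congʳ g {f} {f'} f≈f' = ⊛-cong {f} {f'} {g} {g} f≈f' (λ _ → refl)

module SeriesSolver =
  Algebra.Solver.Ring.NaturalCoefficients.Default (CommutativeRing.commutativeSemiring seriesCommutativeRing)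

⊛-left-comm : ∀ f g h → (f ⊛ (g ⊛ h)) ≈ (g ⊛ (f ⊛ h))
⊛-left-comm = solve 3 (λ f g h → f :* (g :* h) := g :* (f :* h)) ≈-refl
  where open SeriesSolver

sumS : ℕ → (ℕ → Series) → Series
sumS n F k = sumBelow n (λ i → F i k)

sumS-cong-< : ∀ n {F G : ℕ → Series} → (∀ i → i < n → F i ≈ G i) → sumS n F ≈ sumS n G
sumS-cong-< n F≈G k = sumBelow-cong-< n (λ i i<n → F≈G i i<n k)

sumS-cong : ∀ n {F G : ℕ → Series} → (∀ i → F i ≈ G i) → sumS n F ≈ sumS n G
sumS-cong n F≈G = sumS-cong-< n (λ i _ → F≈G i)

sumS-vanish : ∀ n {F : ℕ → Series} → (∀ i → i < n → F i ≈ zeroS) → sumS n F ≈ zeroS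
sumS-vanish n F≈0 k = sumBelow-vanish n (λ i i<n → F≈0 i i<n k)

sumS-⊕ : ∀ n (F G : ℕ → Series) → sumS n (λ i → F i ⊕ G i) ≈ (sumS n F ⊕ sumS n G)
sumS-⊕ n F G k = sumBelow-+ n (λ i → F i k) (λ i → G i k)

⊛-distribʳ-sumS : ∀ n (F : ℕ → Series) g → (sumS n F ⊛ g) ≈ sumS n (λ i → F i ⊛ g)
⊛-distribʳ-sumS zero    F g = ⊛-zeroˡ g
⊛-distribʳ-sumS (suc n) F g =
  ≈-trans (⊛-distribʳ g (sumS n F) (F n)) (⊕-congʳ (F n ⊛ g) (⊛-distribʳ-sumS n F g))

⊛-distribˡ-sumS : ∀ n f (F : ℕ → Series) → (f ⊛ sumS n F) ≈ sumS n (λ i → f ⊛ F i)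
⊛-distribˡ-sumS n f F =
  ≈-trans (⊛-comm f (sumS n F)) (≈-trans (⊛-distribʳ-sumS n F f) (sumS-cong n (λ i → ⊛-comm (F i) f)))

sumS-swap : ∀ n m (F : ℕ → ℕ → Series) →
  sumS n (λ i → sumS m (F i)) ≈ sumS m (λ j → sumS n (λ i → F i j))
sumS-swap n m F k = sumBelow-swap n m (λ i j → F i j k)

sumS-sucˡ : ∀ n (F : ℕ → Series) → sumS (suc n) F ≈ (F 0 ⊕ sumS n (λ i → F (suc i)))
sumS-sucˡ n F k = sumBelow-sucˡ n (λ i → F i k)

sumS-extend : ∀ n d (F : ℕ → Series) → (∀ i → n ≤ i → F i ≈ zeroS) → sumS (n ℕ.+ d) F ≈ sumS n F
sumS-extend n zero    F F≈0 k = cong (λ m → sumS m F k) (ℕP.+-identityʳ n)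
sumS-extend n (suc d) F F≈0 k = begin
  sumS (n ℕ.+ suc d) F k             ≡⟨ cong (λ m → sumS m F k) (ℕP.+-suc n d) ⟩
  sumS (n ℕ.+ d) F k + F (n ℕ.+ d) k ≡⟨ cong₂ _+_ (sumS-extend n d F F≈0 k) (F≈0 (n ℕ.+ d) (ℕP.m≤m+n n d) k) ⟩
  sumS n F k + 0ℚ                    ≡⟨ ℚP.+-identityʳ _ ⟩
  sumS n F k                         ∎
  where open ≡-Reasoning

infix 4 _≈[_]_
_≈[_]_ : Series → ℕ → Series → Set
f ≈[ N ] g = ∀ i → i ≤ N → f i ≡ g i

≈⇒≈[] : ∀ {f g} N → f ≈ g → f ≈[ N ] g
≈⇒≈[] N f≈g i _ = f≈g i

≈[]-sym : ∀ {f g N} → f ≈[ N ] g → g ≈[ N ] f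
≈[]-sym f≈g i i≤N = sym (f≈g i i≤N)

≈[]-trans : ∀ {f g h N} → f ≈[ N ] g → g ≈[ N ] h → f ≈[ N ] h
≈[]-trans f≈g g≈h i i≤N = trans (f≈g i i≤N) (g≈h i i≤N)

truncatedSetoid : ℕ → Setoid _ _
truncatedSetoid N = record
  { Carrier = Series ; _≈_ = _≈[ N ]_
  ; isEquivalence = record { refl = λ _ _ → refl ; sym = ≈[]-sym ; trans = ≈[]-trans } }

-- The coefficient of q^i in a product only involves coefficients of index ≤ i.
⊛-cong[] : ∀ {f f' g g' N} → f ≈[ N ] f' → g ≈[ N ] g' → (f ⊛ g) ≈[ N ] (f' ⊛ g')
⊛-cong[] f≈f' g≈g' i i≤N = sumBelow-cong-< (suc i) (λ j j<si →
  cong₂ _*_ (f≈f' j (ℕP.≤-trans (ℕP.<⇒≤pred j<si) i≤N)) (g≈g' (i ∸ j) (ℕP.≤-trans (ℕP.m∸n≤m i j) i≤N)))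

⊛-congˡ[] : ∀ f {g g' N} → g ≈[ N ] g' → (f ⊛ g) ≈[ N ] (f ⊛ g')
⊛-congˡ[] f = ⊛-cong[] {f} {f} (λ _ _ → refl)

⊛-congʳ[] : ∀ g {f f' N} → f ≈[ N ] f' → (f ⊛ g) ≈[ N ] (f' ⊛ g)
⊛-congʳ[] g {f} {f'} f≈f' = ⊛-cong[] {f} {f'} {g} {g} f≈f' (λ _ _ → refl)

⊕-cong[] : ∀ {f f' g g' N} → f ≈[ N ] f' → g ≈[ N ] g' → (f ⊕ g) ≈[ N ] (f' ⊕ g')
⊕-cong[] f≈f' g≈g' i i≤N = cong₂ _+_ (f≈f' i i≤N) (g≈g' i i≤N)

sumS-cong[] : ∀ n {F G : ℕ → Series} {N} → (∀ i → i < n → F i ≈[ N ] G i) → sumS n F ≈[ N ] sumS n G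
sumS-cong[] n F≈G k k≤N = sumBelow-cong-< n (λ i i<n → F≈G i i<n k k≤N)

qPow-≡ : ∀ k → qPow k k ≡ 1ℚ
qPow-≡ k rewrite dec-true (k ≟ k) refl = refl

qPow-≢ : ∀ {i k} → i ≢ k → qPow k i ≡ 0ℚ
qPow-≢ {i} {k} i≢k rewrite dec-false (i ≟ k) i≢k = refl

sumBelow-select-∉ : ∀ m k (c : ℕ → ℚ) → m ≤ k → sumBelow m (λ i → qPow k i * c i) ≡ 0ℚ
sumBelow-select-∉ m k c m≤k = sumBelow-vanish m (λ i i<m →
  trans (cong (_* c i) (qPow-≢ (ℕP.<⇒≢ (ℕP.<-≤-trans i<m m≤k)))) (ℚP.*-zeroˡ (c i)))

sumBelow-select : ∀ m k (c : ℕ → ℚ) → k < m → sumBelow m (λ i → qPow k i * c i) ≡ c k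
sumBelow-select (suc m) k c k<sm with k ≟ m
... | yes refl = begin
  sumBelow k (λ i → qPow k i * c i) + qPow k k * c k
    ≡⟨ cong₂ _+_ (sumBelow-select-∉ k k c ℕP.≤-refl) (trans (cong (_* c k) (qPow-≡ k)) (ℚP.*-identityˡ (c k))) ⟩
  0ℚ + c k ≡⟨ ℚP.+-identityˡ (c k) ⟩
  c k      ∎
  where open ≡-Reasoning
... | no k≢m = begin
  sumBelow m (λ i → qPow k i * c i) + qPow k m * c m
    ≡⟨ cong₂ _+_ (sumBelow-select m k c (ℕP.≤∧≢⇒< (ℕP.<⇒≤pred k<sm) k≢m))
                 (trans (cong (_* c m) (qPow-≢ (k≢m ∘ sym))) (ℚP.*-zeroˡ (c m))) ⟩
  c k + 0ℚ ≡⟨ ℚP.+-identityʳ (c k) ⟩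
  c k      ∎
  where open ≡-Reasoning

qPow-⊛-≥ : ∀ k f n → k ≤ n → (qPow k ⊛ f) n ≡ f (n ∸ k)
qPow-⊛-≥ k f n k≤n = sumBelow-select (suc n) k (λ i → f (n ∸ i)) (s≤s k≤n)

qPow-⊛-< : ∀ k f n → n < k → (qPow k ⊛ f) n ≡ 0ℚ
qPow-⊛-< k f n n<k = sumBelow-select-∉ (suc n) k (λ i → f (n ∸ i)) n<k

qPow-⊛-≈[]0 : ∀ k f N → N < k → (qPow k ⊛ f) ≈[ N ] zeroS
qPow-⊛-≈[]0 k f N N<k i i≤N = qPow-⊛-< k f i (ℕP.≤-<-trans i≤N N<k)

qPow-+ : ∀ i j → (qPow i ⊛ qPow j) ≈ qPow (i ℕ.+ j)
qPow-+ i j n with i ℕP.≤? n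
... | no i≰n = trans (qPow-⊛-< i (qPow j) n (ℕP.≰⇒> i≰n))
                     (sym (qPow-≢ (λ n≡i+j → i≰n (subst (i ≤_) (sym n≡i+j) (ℕP.m≤m+n i j)))))
... | yes i≤n = trans (qPow-⊛-≥ i (qPow j) n i≤n) (coefficient (n ≟ i ℕ.+ j))
  where
  coefficient : Dec (n ≡ i ℕ.+ j) → qPow j (n ∸ i) ≡ qPow (i ℕ.+ j) n
  coefficient (yes refl) = trans (cong (qPow j) (ℕP.m+n∸m≡n i j)) (trans (qPow-≡ j) (sym (qPow-≡ (i ℕ.+ j))))
  coefficient (no n≢i+j) =
    trans (qPow-≢ (λ n∸i≡j → n≢i+j (trans (sym (ℕP.m+[n∸m]≡n i≤n)) (cong (i ℕ.+_) n∸i≡j)))) (sym (qPow-≢ n≢i+j))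

gate : ℕ → ℕ → Series → Series
gate X Y s = if X ℕ.<ᵇ Y then s else zeroS

gate-< : ∀ {X Y} s → X < Y → gate X Y s ≈ s
gate-< {X} {Y} s X<Y with X ℕ.<ᵇ Y | ℕP.<⇒<ᵇ X<Y
... | true | _ = ≈-refl

gate-≮ : ∀ {X Y} s → ¬ X < Y → gate X Y s ≈ zeroS
gate-≮ {X} {Y} s X≮Y with X ℕ.<ᵇ Y | ℕP.<ᵇ⇒< X Y
... | true  | X<Y = ⊥-elim (X≮Y (X<Y _))
... | false | _   = ≈-refl

gate-cong : ∀ X Y {s t} → s ≈ t → gate X Y s ≈ gate X Y t
gate-cong X Y s≈t with X ℕ.<ᵇ Y
... | true  = s≈t
... | false = ≈-refl

gate-cong[] : ∀ X Y {s t} N → (X < Y → s ≈[ N ] t) → gate X Y s ≈[ N ] gate X Y t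
gate-cong[] X Y N s≈t with X <? Y
... | yes X<Y = ≈[]-trans (≈⇒≈[] N (gate-< _ X<Y)) (≈[]-trans (s≈t X<Y) (≈⇒≈[] N (≈-sym (gate-< _ X<Y))))
... | no  X≮Y = ≈⇒≈[] N (≈-trans (gate-≮ _ X≮Y) (≈-sym (gate-≮ _ X≮Y)))

gate-⊕ : ∀ X Y s t → gate X Y (s ⊕ t) ≈ (gate X Y s ⊕ gate X Y t)
gate-⊕ X Y s t with X ℕ.<ᵇ Y
... | true  = ≈-refl
... | false = λ _ → sym (ℚP.+-identityʳ 0ℚ)

gate-⊛ˡ : ∀ X Y c s → gate X Y (c ⊛ s) ≈ (c ⊛ gate X Y s)
gate-⊛ˡ X Y c s with X ℕ.<ᵇ Y
... | true  = ≈-refl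
... | false = ≈-sym (⊛-zeroʳ c)

gate-⊛ʳ : ∀ X Y c s → gate X Y (s ⊛ c) ≈ (gate X Y s ⊛ c)
gate-⊛ʳ X Y c s with X ℕ.<ᵇ Y
... | true  = ≈-refl
... | false = ≈-sym (⊛-zeroˡ c)

gate-sumS : ∀ X Y n (F : ℕ → Series) → gate X Y (sumS n F) ≈ sumS n (λ i → gate X Y (F i))
gate-sumS X Y n F with X ℕ.<ᵇ Y
... | true  = ≈-refl
... | false = ≈-sym (sumS-vanish n (λ _ _ → ≈-refl))

sumAbove : ℕ → (ℕ → Series) → ℕ → Series
sumAbove L f X = sumS L (λ Y → gate X Y (f Y))

sumAbove-empty : ∀ L f X → L ≤ suc X → sumAbove L f X ≈ zeroS
sumAbove-empty L f X L≤sX = sumS-vanish L (λ Y Y<L →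
  gate-≮ (f Y) (λ X<Y → ℕP.<⇒≱ X<Y (ℕP.<⇒≤pred (ℕP.<-≤-trans Y<L L≤sX))))

sumAbove-sucʳ : ∀ L f X → X < L → sumAbove (suc L) f X ≈ (sumAbove L f X ⊕ f L)
sumAbove-sucʳ L f X X<L = ⊕-congˡ (sumAbove L f X) (gate-< (f L) X<L)

sumAbove-sucˡ : ∀ L f X → suc X < L → sumAbove L f X ≈ (f (suc X) ⊕ sumAbove L f (suc X))
sumAbove-sucˡ (suc L) f X sX<sL with ℕP.m≤n⇒m<n∨m≡n (ℕP.<⇒≤pred sX<sL)
... | inj₁ sX<L = begin
  sumAbove (suc L) f X                                ≈⟨ sumAbove-sucʳ L f X (ℕP.<-trans (ℕP.n<1+n X) sX<L) ⟩
  sumAbove L f X ⊕ f L                                ≈⟨ ⊕-congʳ (f L) (sumAbove-sucˡ L f X sX<L) ⟩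
  (f (suc X) ⊕ sumAbove L f (suc X)) ⊕ f L            ≈⟨ (λ k → ℚP.+-assoc (f (suc X) k) _ (f L k)) ⟩
  f (suc X) ⊕ (sumAbove L f (suc X) ⊕ f L)            ≈⟨ ⊕-congˡ (f (suc X)) (≈-sym (sumAbove-sucʳ L f (suc X) sX<L)) ⟩
  f (suc X) ⊕ sumAbove (suc L) f (suc X)              ∎
  where open SetoidReasoning (CommutativeRing.setoid seriesCommutativeRing)
... | inj₂ refl = begin
  sumAbove (suc (suc X)) f X
    ≈⟨ sumAbove-sucʳ (suc X) f X (ℕP.n<1+n X) ⟩
  sumAbove (suc X) f X ⊕ f (suc X)
    ≈⟨ ⊕-congʳ (f (suc X)) (sumAbove-empty (suc X) f X ℕP.≤-refl) ⟩
  zeroS ⊕ f (suc X)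
    ≈⟨ (λ k → ℚP.+-comm 0ℚ (f (suc X) k)) ⟩
  f (suc X) ⊕ zeroS
    ≈⟨ ⊕-congˡ (f (suc X)) (≈-sym (sumAbove-empty (suc (suc X)) f (suc X) ℕP.≤-refl)) ⟩
  f (suc X) ⊕ sumAbove (suc (suc X)) f (suc X) ∎
  where open SetoidReasoning (CommutativeRing.setoid seriesCommutativeRing)

sumAbove-cong-< : ∀ L {f g : ℕ → Series} X → (∀ Y → Y < L → f Y ≈ g Y) → sumAbove L f X ≈ sumAbove L g X
sumAbove-cong-< L X f≈g = sumS-cong-< L (λ Y Y<L → gate-cong X Y (f≈g Y Y<L))

sumAbove-cong : ∀ L {f g : ℕ → Series} X → (∀ Y → f Y ≈ g Y) → sumAbove L f X ≈ sumAbove L g X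
sumAbove-cong L X f≈g = sumAbove-cong-< L X (λ Y _ → f≈g Y)

sumAbove-⊕ : ∀ L (f g : ℕ → Series) X → sumAbove L (λ Y → f Y ⊕ g Y) X ≈ (sumAbove L f X ⊕ sumAbove L g X)
sumAbove-⊕ L f g X = ≈-trans (sumS-cong L (λ Y → gate-⊕ X Y (f Y) (g Y))) (sumS-⊕ L _ _)

⊛-distribˡ-sumAbove : ∀ L c (f : ℕ → Series) X → (c ⊛ sumAbove L f X) ≈ sumAbove L (λ Y → c ⊛ f Y) X
⊛-distribˡ-sumAbove L c f X =
  ≈-trans (⊛-distribˡ-sumS L c (λ Y → gate X Y (f Y))) (sumS-cong L (λ Y → ≈-sym (gate-⊛ˡ X Y c (f Y))))

⊛-distribʳ-sumAbove : ∀ L c (f : ℕ → Series) X → (sumAbove L f X ⊛ c) ≈ sumAbove L (λ Y → f Y ⊛ c) X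
⊛-distribʳ-sumAbove L c f X =
  ≈-trans (⊛-distribʳ-sumS L (λ Y → gate X Y (f Y)) c) (sumS-cong L (λ Y → ≈-sym (gate-⊛ʳ X Y c (f Y))))

sumAbove-vanish : ∀ L (f : ℕ → Series) X → (∀ Y → f Y ≈ zeroS) → sumAbove L f X ≈ zeroS
sumAbove-vanish L f X f≈0 = sumS-vanish L (λ Y _ → ≈-trans (gate-cong X Y (f≈0 Y)) (gate-0 X Y))
  where
  gate-0 : ∀ X Y → gate X Y zeroS ≈ zeroS
  gate-0 X Y with X ℕ.<ᵇ Y
  ... | true  = ≈-refl
  ... | false = ≈-refl

geomS-unfold : ∀ m → geomS m ≈ (oneS ⊕ (qPow (suc m) ⊛ geomS m))
geomS-unfold m i with i ℕP.≤? m
... | yes i≤m = begin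
  geomS m i                           ≡⟨ cong (λ r → if does (r ≟ 0) then 1ℚ else 0ℚ) (m≤n⇒m%n≡m i≤m) ⟩
  oneS i                              ≡⟨ sym (ℚP.+-identityʳ (oneS i)) ⟩
  oneS i + 0ℚ                         ≡⟨ cong (oneS i +_) (sym (qPow-⊛-< (suc m) (geomS m) i (s≤s i≤m))) ⟩
  oneS i + (qPow (suc m) ⊛ geomS m) i ∎
  where open ≡-Reasoning
... | no i≰m = begin
  geomS m i                           ≡⟨ cong (geomS m) (sym (ℕP.m∸n+n≡m sm≤i)) ⟩
  geomS m (i ∸ suc m ℕ.+ suc m)       ≡⟨ cong (λ r → if does (r ≟ 0) then 1ℚ else 0ℚ) ([m+n]%n≡m%n (i ∸ suc m) (suc m)) ⟩
  geomS m (i ∸ suc m)                 ≡⟨ sym (ℚP.+-identityˡ _) ⟩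
  0ℚ + geomS m (i ∸ suc m)            ≡⟨ cong₂ _+_ (sym (qPow-≢ (ℕP.m<n⇒n≢0 sm≤i)))
                                                     (sym (qPow-⊛-≥ (suc m) (geomS m) i sm≤i)) ⟩
  oneS i + (qPow (suc m) ⊛ geomS m) i ∎
  where
  open ≡-Reasoning
  sm≤i : suc m ≤ i
  sm≤i = ℕP.≰⇒> i≰m

oneMinusQ-inverse : (oneMinusQ ⊛ geomS 0) ≈ oneS
oneMinusQ-inverse = begin
  oneMinusQ ⊛ g                   ≈⟨ ⊛-congʳ g oneMinusQ≈1-q ⟩
  (oneS ⊕ negS q) ⊛ g             ≈⟨ ⊛-distribʳ g oneS (negS q) ⟩
  (oneS ⊛ g) ⊕ (negS q ⊛ g)       ≈⟨ ⊕-cong (⊛-identityˡ g) (≈-sym (-‿distribˡ-* q g)) ⟩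
  g ⊕ negS (q ⊛ g)                ≈⟨ ⊕-congʳ (negS (q ⊛ g)) (geomS-unfold 0) ⟩
  (oneS ⊕ (q ⊛ g)) ⊕ negS (q ⊛ g) ≈⟨ (λ n → +-cancelʳ (oneS n) ((q ⊛ g) n)) ⟩
  oneS                            ∎
  where
  open SetoidReasoning (CommutativeRing.setoid seriesCommutativeRing)
  g q : Series
  g = geomS 0
  q = qPow 1
  oneMinusQ≈1-q : oneMinusQ ≈ (oneS ⊕ negS q)
  oneMinusQ≈1-q zero          = refl
  oneMinusQ≈1-q (suc zero)    = refl
  oneMinusQ≈1-q (suc (suc n)) = refl
  +-cancelʳ : ∀ a b → (a + b) + - b ≡ a
  +-cancelʳ = solve 2 (λ a b → (a :+ b) :+ :- b := a) refl
    where open +-*-Solver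

-- y M = q^M / (1 - q^M).  As 0 ∸ 1 = 0, y 0 is the junk value 1 / (1 - q); it only ever
-- meets factors vanishing at M = 0.
y : ℕ → Series
y M = qPow M ⊛ geomS (M ∸ 1)

qPow⊛y-unfold : ∀ p A →
  (qPow (suc p ℕ.* A) ⊛ y (suc p)) ≈ (qPow (suc p ℕ.* suc A) ⊕ (qPow (suc p ℕ.* suc A) ⊛ y (suc p)))
qPow⊛y-unfold p A = begin
  qA ⊛ (qP ⊛ g)                               ≈⟨ ⊛-congˡ qA (⊛-congˡ qP (geomS-unfold p)) ⟩
  qA ⊛ (qP ⊛ (oneS ⊕ (qP ⊛ g)))               ≈⟨ solve 4 (λ qA qP o g → qA :* (qP :* (o :+ qP :* g))
                                                    := (qP :* qA) :* o :+ (qP :* qA) :* (qP :* g)) ≈-refl qA qP oneS g ⟩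
  ((qP ⊛ qA) ⊛ oneS) ⊕ ((qP ⊛ qA) ⊛ (qP ⊛ g)) ≈⟨ ⊕-cong (≈-trans (⊛-identityʳ (qP ⊛ qA)) qP⊛qA) (⊛-congʳ (qP ⊛ g) qP⊛qA) ⟩
  qPow (suc p ℕ.* suc A) ⊕ (qPow (suc p ℕ.* suc A) ⊛ (qP ⊛ g)) ∎
  where
  open SetoidReasoning (CommutativeRing.setoid seriesCommutativeRing)
  open SeriesSolver
  qA qP g : Series
  qA = qPow (suc p ℕ.* A)
  qP = qPow (suc p)
  g  = geomS p
  qP⊛qA : (qP ⊛ qA) ≈ qPow (suc p ℕ.* suc A)
  qP⊛qA n = trans (qPow-+ (suc p) (suc p ℕ.* A) n) (cong (λ e → qPow e n) (sym (ℕP.*-suc (suc p) A)))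

qPow⊛y≈[]0 : ∀ p A N → N ≤ A → (qPow (suc p ℕ.* A) ⊛ y (suc p)) ≈[ N ] zeroS
qPow⊛y≈[]0 p A N N≤A = ≈[]-trans (≈⇒≈[] N shifted) (qPow-⊛-≈[]0 (P ℕ.* A ℕ.+ P) (geomS p) N N<PA+P)
  where
  P : ℕ
  P = suc p
  shifted : (qPow (P ℕ.* A) ⊛ y P) ≈ (qPow (P ℕ.* A ℕ.+ P) ⊛ geomS p)
  shifted = ≈-trans (≈-sym (⊛-assoc (qPow (P ℕ.* A)) (qPow P) (geomS p))) (⊛-congʳ (geomS p) (qPow-+ (P ℕ.* A) P))
  N<PA+P : N < P ℕ.* A ℕ.+ P
  N<PA+P = ℕP.≤-trans (s≤s N≤A)
             (subst (_≤ P ℕ.* A ℕ.+ P) (ℕP.+-comm A 1) (ℕP.+-mono-≤ (ℕP.m≤m+n A (p ℕ.* A)) (s≤s z≤n)))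

-- The expansion y P = Σ_{j ≥ 1} q^{P j}, shifted by q^{P A} and cut off at L.
qPow⊛y≈[]sumAbove : ∀ p A N L → N < L →
  (qPow (suc p ℕ.* A) ⊛ y (suc p)) ≈[ N ] sumAbove L (λ Y → qPow (suc p ℕ.* Y)) A
qPow⊛y≈[]sumAbove p A N L N<L = go L A (ℕP.m≤n+m L A)
  where
  go : ∀ d A → L ≤ A ℕ.+ d → (qPow (suc p ℕ.* A) ⊛ y (suc p)) ≈[ N ] sumAbove L (λ Y → qPow (suc p ℕ.* Y)) A
  go d A L≤A+d with L ℕP.≤? suc A
  go d       A L≤A+d | yes L≤sA =
    ≈[]-trans (qPow⊛y≈[]0 p A N (ℕP.<⇒≤pred (ℕP.<-≤-trans N<L L≤sA))) (≈⇒≈[] N (≈-sym (sumAbove-empty L _ A L≤sA)))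
  go zero    A L≤A+0 | no  L≰sA =
    ⊥-elim (L≰sA (ℕP.≤-trans L≤A+0 (ℕP.≤-trans (ℕP.≤-reflexive (ℕP.+-identityʳ A)) (ℕP.n≤1+n A))))
  go (suc d) A L≤A+sd | no L≰sA =
    ≈[]-trans (≈⇒≈[] N (qPow⊛y-unfold p A))
    (≈[]-trans (⊕-cong[] {qPow (suc p ℕ.* suc A)} (λ _ _ → refl)
                         (go d (suc A) (ℕP.≤-trans L≤A+sd (ℕP.≤-reflexive (ℕP.+-suc A d)))))
               (≈⇒≈[] N (≈-sym (sumAbove-sucˡ L _ A (ℕP.≰⇒> L≰sA)))))

powS-+ : ∀ f m n → powS f (m ℕ.+ n) ≈ (powS f m ⊛ powS f n)
powS-+ f zero    n = ≈-sym (⊛-identityˡ (powS f n))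
powS-+ f (suc m) n = ≈-trans (⊛-congˡ f (powS-+ f m n)) (≈-sym (⊛-assoc f (powS f m) (powS f n)))

hbarPow-⊖ : ∀ m n → hbarPow (m ⊖ n) ≈ (powS oneMinusQ m ⊛ powS (geomS 0) n)
hbarPow-⊖ m       zero    = ≈-sym (⊛-identityʳ (powS oneMinusQ m))
hbarPow-⊖ zero    (suc n) = ≈-sym (⊛-identityˡ (powS (geomS 0) (suc n)))
hbarPow-⊖ (suc m) (suc n) = begin
  hbarPow (suc m ⊖ suc n)    ≈⟨ (λ k → cong (λ e → hbarPow e k) (ℤP.[1+m]⊖[1+n]≡m⊖n m n)) ⟩
  hbarPow (m ⊖ n)            ≈⟨ hbarPow-⊖ m n ⟩
  hᵐ ⊛ gⁿ                    ≈⟨ ≈-sym (⊛-identityˡ (hᵐ ⊛ gⁿ)) ⟩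
  oneS ⊛ (hᵐ ⊛ gⁿ)           ≈⟨ ⊛-congʳ (hᵐ ⊛ gⁿ) (≈-sym oneMinusQ-inverse) ⟩
  (h ⊛ g) ⊛ (hᵐ ⊛ gⁿ)       ≈⟨ solve 4 (λ h g hᵐ gⁿ → (h :* g) :* (hᵐ :* gⁿ) := (h :* hᵐ) :* (g :* gⁿ)) ≈-refl h g hᵐ gⁿ ⟩
  (h ⊛ hᵐ) ⊛ (g ⊛ gⁿ)        ∎
  where
  open SetoidReasoning (CommutativeRing.setoid seriesCommutativeRing)
  open SeriesSolver
  h g hᵐ gⁿ : Series
  h  = oneMinusQ
  g  = geomS 0
  hᵐ = powS oneMinusQ m
  gⁿ = powS (geomS 0) n

hbarPow-+ : ∀ e e' → hbarPow (e ℤ.+ e') ≈ (hbarPow e ⊛ hbarPow e')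
hbarPow-+ (ℤ.+ m)    (ℤ.+ n)    = powS-+ oneMinusQ m n
hbarPow-+ (ℤ.+ m)    -[1+ n ] = hbarPow-⊖ m (suc n)
hbarPow-+ -[1+ m ] (ℤ.+ n)    = ≈-trans (hbarPow-⊖ n (suc m)) (⊛-comm (powS oneMinusQ n) (powS (geomS 0) (suc m)))
hbarPow-+ -[1+ m ] -[1+ n ] =
  ≈-trans (λ k → cong (λ e → powS (geomS 0) e k) (sym (ℕP.+-suc (suc m) n))) (powS-+ (geomS 0) (suc m) (suc n))

scaleS-⊛ : ∀ c f g → (scaleS c f ⊛ g) ≈ scaleS c (f ⊛ g)
scaleS-⊛ c f g n = trans (sumBelow-cong (suc n) (λ i → ℚP.*-assoc c (f i) (g (n ∸ i))))
                         (sym (*-distribˡ-sumBelow (suc n) c (λ i → f i * g (n ∸ i))))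

actC-++ : ∀ c d → actC (c ++ d) ≈ (actC c ⊕ actC d)
actC-++ []            d n = sym (ℚP.+-identityˡ (actC d n))
actC-++ ((e , x) ∷ c) d n =
  trans (cong (scaleS x (hbarPow e) n +_) (actC-++ c d n)) (sym (ℚP.+-assoc (scaleS x (hbarPow e) n) (actC c n) (actC d n)))

actC-monomial·C : ∀ e x d →
  actC (map (λ { (e' , x') → (e ℤ.+ e' , x * x') }) d) ≈ (scaleS x (hbarPow e) ⊛ actC d)
actC-monomial·C e x [] = ≈-sym (⊛-zeroʳ (scaleS x (hbarPow e)))
actC-monomial·C e x ((e' , x') ∷ d) =
  ≈-trans (⊕-cong monomial (actC-monomial·C e x d))
          (≈-sym (⊛-distribˡ (scaleS x (hbarPow e)) (scaleS x' (hbarPow e')) (actC d)))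
  where
  open ≡-Reasoning
  monomial : scaleS (x * x') (hbarPow (e ℤ.+ e')) ≈ (scaleS x (hbarPow e) ⊛ scaleS x' (hbarPow e'))
  monomial n = begin
    (x * x') * hbarPow (e ℤ.+ e') n                 ≡⟨ cong ((x * x') *_) (hbarPow-+ e e' n) ⟩
    (x * x') * (hbarPow e ⊛ hbarPow e') n           ≡⟨ ℚP.*-assoc x x' _ ⟩
    x * (x' * (hbarPow e ⊛ hbarPow e') n)           ≡⟨ cong (λ r → x * (x' * r)) (⊛-comm (hbarPow e) (hbarPow e') n) ⟩
    x * (x' * (hbarPow e' ⊛ hbarPow e) n)           ≡⟨ cong (x *_) (sym (scaleS-⊛ x' (hbarPow e') (hbarPow e) n)) ⟩
    x * (scaleS x' (hbarPow e') ⊛ hbarPow e) n      ≡⟨ cong (x *_) (⊛-comm (scaleS x' (hbarPow e')) (hbarPow e) n) ⟩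
    x * (hbarPow e ⊛ scaleS x' (hbarPow e')) n      ≡⟨ sym (scaleS-⊛ x (hbarPow e) (scaleS x' (hbarPow e')) n) ⟩
    (scaleS x (hbarPow e) ⊛ scaleS x' (hbarPow e')) n ∎

actC-·C : ∀ c d → actC (c ·C d) ≈ (actC c ⊛ actC d)
actC-·C []            d = ≈-sym (⊛-zeroˡ (actC d))
actC-·C ((e , x) ∷ c) d =
  ≈-trans (actC-++ (map (λ { (e' , x') → (e ℤ.+ e' , x * x') }) d) (c ·C d))
  (≈-trans (⊕-cong (actC-monomial·C e x d) (actC-·C c d)) (≈-sym (⊛-distribʳ (actC d) (scaleS x (hbarPow e)) (actC c))))

actC-oneC : actC oneC ≈ oneS
actC-oneC n = trans (ℚP.+-identityʳ (1ℚ * oneS n)) (ℚP.*-identityˡ (oneS n))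

actC-ħ : actC ((ℤ.+ 1 , 1ℚ) ∷ []) ≈ oneMinusQ
actC-ħ n = trans (ℚP.+-identityʳ _) (trans (ℚP.*-identityˡ _) (⊛-identityʳ oneMinusQ n))

actC-minusOne-⊛ : ∀ f → (actC ((ℤ.+ 0 , - 1ℚ) ∷ []) ⊛ f) ≈ negS f
actC-minusOne-⊛ f = ≈-trans (⊛-congʳ f minusOne) (≈-trans (≈-sym (-‿distribˡ-* oneS f)) (λ n → cong -_ (⊛-identityˡ f n)))
  where
  minusOne : actC ((ℤ.+ 0 , - 1ℚ) ∷ []) ≈ negS oneS
  minusOne n = trans (ℚP.+-identityʳ _) (trans (sym (ℚP.neg-distribˡ-* 1ℚ (oneS n))) (cong -_ (ℚP.*-identityˡ (oneS n))))

-- Iterated sums and the q-shuffle product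

-- The term Y = L vanishes since its inner sum over L < Z < L + 1 is empty
sumAbove-⊛-sumAbove-sucʳ : ∀ L (f g : ℕ → Series) X → X < L →
  sumAbove (suc L) (λ Y → f Y ⊛ sumAbove (suc L) g Y) X ≈
  (sumAbove L (λ Y → f Y ⊛ sumAbove L g Y) X ⊕ (sumAbove L f X ⊛ g L))
sumAbove-⊛-sumAbove-sucʳ L f g X X<L = begin
  sumAbove (suc L) (λ Y → f Y ⊛ sumAbove (suc L) g Y) X
    ≈⟨ sumAbove-sucʳ L _ X X<L ⟩
  sumAbove L (λ Y → f Y ⊛ sumAbove (suc L) g Y) X ⊕ (f L ⊛ sumAbove (suc L) g L)
    ≈⟨ ⊕-congˡ (sumAbove L (λ Y → f Y ⊛ sumAbove (suc L) g Y) X)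
               (≈-trans (⊛-congˡ (f L) (sumAbove-empty (suc L) g L ℕP.≤-refl)) (⊛-zeroʳ (f L))) ⟩
  sumAbove L (λ Y → f Y ⊛ sumAbove (suc L) g Y) X ⊕ zeroS
    ≈⟨ (λ k → ℚP.+-identityʳ _) ⟩
  sumAbove L (λ Y → f Y ⊛ sumAbove (suc L) g Y) X
    ≈⟨ sumAbove-cong-< L X (λ Y Y<L → ≈-trans (⊛-congˡ (f Y) (sumAbove-sucʳ L g Y Y<L))
                                              (⊛-distribˡ (f Y) (sumAbove L g Y) (g L))) ⟩
  sumAbove L (λ Y → (f Y ⊛ sumAbove L g Y) ⊕ (f Y ⊛ g L)) X
    ≈⟨ sumAbove-⊕ L _ _ X ⟩
  sumAbove L (λ Y → f Y ⊛ sumAbove L g Y) X ⊕ sumAbove L (λ Y → f Y ⊛ g L) X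
    ≈⟨ ⊕-congˡ (sumAbove L (λ Y → f Y ⊛ sumAbove L g Y) X) (≈-sym (⊛-distribʳ-sumAbove L (g L) f X)) ⟩
  sumAbove L (λ Y → f Y ⊛ sumAbove L g Y) X ⊕ (sumAbove L f X ⊛ g L) ∎
  where open SetoidReasoning (CommutativeRing.setoid seriesCommutativeRing)

sumAbove-rotaBaxter : ∀ L (f g : ℕ → Series) X →
  (sumAbove L f X ⊛ sumAbove L g X) ≈
  ((sumAbove L (λ Y → f Y ⊛ sumAbove L g Y) X ⊕ sumAbove L (λ Y → sumAbove L f Y ⊛ g Y) X)
    ⊕ sumAbove L (λ Y → f Y ⊛ g Y) X)
sumAbove-rotaBaxter zero f g X =
  ≈-trans (⊛-zeroˡ zeroS) (λ k → sym (trans (ℚP.+-identityʳ _) (ℚP.+-identityʳ 0ℚ)))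
sumAbove-rotaBaxter (suc L) f g X with X <? L
... | no X≮L = ≈-trans (⊛-congʳ (sumAbove (suc L) g X) (empty f)) (≈-trans (⊛-zeroˡ (sumAbove (suc L) g X))
                 (λ k → sym (trans (cong₂ _+_ (cong₂ _+_ (empty _ k) (empty _ k)) (empty _ k))
                                   (trans (ℚP.+-identityʳ _) (ℚP.+-identityʳ 0ℚ)))))
  where
  empty : ∀ h → sumAbove (suc L) h X ≈ zeroS
  empty h = sumAbove-empty (suc L) h X (s≤s (ℕP.≮⇒≥ X≮L))
... | yes X<L = begin
  sumAbove (suc L) f X ⊛ sumAbove (suc L) g X
    ≈⟨ ⊛-cong (sumAbove-sucʳ L f X X<L) (sumAbove-sucʳ L g X X<L) ⟩
  (Sf ⊕ f L) ⊛ (Sg ⊕ g L)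
    ≈⟨ solve 4 (λ Sf Sg fL gL → (Sf :+ fL) :* (Sg :+ gL) := Sf :* Sg :+ ((Sf :* gL :+ fL :* Sg) :+ fL :* gL))
               ≈-refl Sf Sg (f L) (g L) ⟩
  (Sf ⊛ Sg) ⊕ (((Sf ⊛ g L) ⊕ (f L ⊛ Sg)) ⊕ (f L ⊛ g L))
    ≈⟨ ⊕-congʳ _ (sumAbove-rotaBaxter L f g X) ⟩
  ((R₁ ⊕ R₂) ⊕ R₃) ⊕ (((Sf ⊛ g L) ⊕ (f L ⊛ Sg)) ⊕ (f L ⊛ g L))
    ≈⟨ solve 6 (λ R₁ R₂ R₃ u v w → ((R₁ :+ R₂) :+ R₃) :+ ((u :+ v) :+ w) := ((R₁ :+ u) :+ (R₂ :+ v)) :+ (R₃ :+ w))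
               ≈-refl R₁ R₂ R₃ (Sf ⊛ g L) (f L ⊛ Sg) (f L ⊛ g L) ⟩
  ((R₁ ⊕ (Sf ⊛ g L)) ⊕ (R₂ ⊕ (f L ⊛ Sg))) ⊕ (R₃ ⊕ (f L ⊛ g L))
    ≈⟨ ⊕-cong (⊕-cong (≈-sym (sumAbove-⊛-sumAbove-sucʳ L f g X X<L)) (≈-sym mirrored))
              (≈-sym (sumAbove-sucʳ L (λ Y → f Y ⊛ g Y) X X<L)) ⟩
  (sumAbove (suc L) (λ Y → f Y ⊛ sumAbove (suc L) g Y) X ⊕ sumAbove (suc L) (λ Y → sumAbove (suc L) f Y ⊛ g Y) X)
    ⊕ sumAbove (suc L) (λ Y → f Y ⊛ g Y) X ∎
  where
  open SetoidReasoning (CommutativeRing.setoid seriesCommutativeRing)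
  open SeriesSolver
  Sf Sg R₁ R₂ R₃ : Series
  Sf = sumAbove L f X
  Sg = sumAbove L g X
  R₁ = sumAbove L (λ Y → f Y ⊛ sumAbove L g Y) X
  R₂ = sumAbove L (λ Y → sumAbove L f Y ⊛ g Y) X
  R₃ = sumAbove L (λ Y → f Y ⊛ g Y) X

  mirrored : sumAbove (suc L) (λ Y → sumAbove (suc L) f Y ⊛ g Y) X ≈ (R₂ ⊕ (f L ⊛ Sg))
  mirrored = begin
    sumAbove (suc L) (λ Y → sumAbove (suc L) f Y ⊛ g Y) X
      ≈⟨ sumAbove-cong (suc L) X (λ Y → ⊛-comm (sumAbove (suc L) f Y) (g Y)) ⟩
    sumAbove (suc L) (λ Y → g Y ⊛ sumAbove (suc L) f Y) X
      ≈⟨ sumAbove-⊛-sumAbove-sucʳ L g f X X<L ⟩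
    sumAbove L (λ Y → g Y ⊛ sumAbove L f Y) X ⊕ (Sg ⊛ f L)
      ≈⟨ ⊕-cong (sumAbove-cong L X (λ Y → ⊛-comm (g Y) (sumAbove L f Y))) (⊛-comm Sg (f L)) ⟩
    R₂ ⊕ (f L ⊛ Sg) ∎

wordOp : ℕ → Word → (ℕ → Series) → ℕ → Series
wordOp L []      f X = f X
wordOp L (a ∷ w) f X = oneMinusQ ⊛ sumAbove L (wordOp L w f) X
wordOp L (b ∷ w) f X = y X ⊛ wordOp L w f X

iteratedSum : ℕ → Word → ℕ → Series
iteratedSum L w = wordOp L w (λ _ → oneS)

sumOver : {A : Set} → (A → Series) → List A → Series
sumOver F []      = zeroS
sumOver F (t ∷ l) = F t ⊕ sumOver F l

iteratedSumTerm : ℕ → ℕ → C × Word → Series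
iteratedSumTerm L X (c , w) = actC c ⊛ iteratedSum L w X

iteratedSumH : ℕ → H → ℕ → Series
iteratedSumH L h X = sumOver (iteratedSumTerm L X) h

wordOp-cong : ∀ L x {f g : ℕ → Series} → (∀ Y → f Y ≈ g Y) → ∀ X → wordOp L x f X ≈ wordOp L x g X
wordOp-cong L []      f≈g X = f≈g X
wordOp-cong L (a ∷ x) f≈g X = ⊛-congˡ oneMinusQ (sumAbove-cong L X (wordOp-cong L x f≈g))
wordOp-cong L (b ∷ x) f≈g X = ⊛-congˡ (y X) (wordOp-cong L x f≈g X)

wordOp-⊕ : ∀ L x (f g : ℕ → Series) X → wordOp L x (λ Y → f Y ⊕ g Y) X ≈ (wordOp L x f X ⊕ wordOp L x g X)
wordOp-⊕ L []      f g X = ≈-refl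
wordOp-⊕ L (a ∷ x) f g X =
  ≈-trans (⊛-congˡ oneMinusQ (≈-trans (sumAbove-cong L X (wordOp-⊕ L x f g)) (sumAbove-⊕ L _ _ X)))
          (⊛-distribˡ oneMinusQ (sumAbove L (wordOp L x f) X) (sumAbove L (wordOp L x g) X))
wordOp-⊕ L (b ∷ x) f g X =
  ≈-trans (⊛-congˡ (y X) (wordOp-⊕ L x f g X)) (⊛-distribˡ (y X) (wordOp L x f X) (wordOp L x g X))

wordOp-⊛ : ∀ L x c (f : ℕ → Series) X → wordOp L x (λ Y → c ⊛ f Y) X ≈ (c ⊛ wordOp L x f X)
wordOp-⊛ L []      c f X = ≈-refl
wordOp-⊛ L (a ∷ x) c f X =
  ≈-trans (⊛-congˡ oneMinusQ (≈-trans (sumAbove-cong L X (wordOp-⊛ L x c f)) (≈-sym (⊛-distribˡ-sumAbove L c _ X))))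
          (⊛-left-comm oneMinusQ c (sumAbove L (wordOp L x f) X))
wordOp-⊛ L (b ∷ x) c f X =
  ≈-trans (⊛-congˡ (y X) (wordOp-⊛ L x c f X)) (⊛-left-comm (y X) c (wordOp L x f X))

wordOp-vanish : ∀ L x (f : ℕ → Series) X → (∀ Y → f Y ≈ zeroS) → wordOp L x f X ≈ zeroS
wordOp-vanish L []      f X f≈0 = f≈0 X
wordOp-vanish L (a ∷ x) f X f≈0 =
  ≈-trans (⊛-congˡ oneMinusQ (sumAbove-vanish L _ X (λ Y → wordOp-vanish L x f Y f≈0))) (⊛-zeroʳ oneMinusQ)
wordOp-vanish L (b ∷ x) f X f≈0 = ≈-trans (⊛-congˡ (y X) (wordOp-vanish L x f X f≈0)) (⊛-zeroʳ (y X))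

wordOp-++ : ∀ L x w f X → wordOp L (x ++ w) f X ≈ wordOp L x (wordOp L w f) X
wordOp-++ L []      w f X = ≈-refl
wordOp-++ L (a ∷ x) w f X = ⊛-congˡ oneMinusQ (sumAbove-cong L X (wordOp-++ L x w f))
wordOp-++ L (b ∷ x) w f X = ⊛-congˡ (y X) (wordOp-++ L x w f X)

sumOver-++ : ∀ {A : Set} (F : A → Series) l l' → sumOver F (l ++ l') ≈ (sumOver F l ⊕ sumOver F l')
sumOver-++ F []      l' n = sym (ℚP.+-identityˡ (sumOver F l' n))
sumOver-++ F (t ∷ l) l' n =
  trans (cong (F t n +_) (sumOver-++ F l l' n)) (sym (ℚP.+-assoc (F t n) (sumOver F l n) (sumOver F l' n)))

iteratedSumH-mulLeft : ∀ L c x h X → iteratedSumH L (mulLeft c x h) X ≈ (actC c ⊛ wordOp L x (iteratedSumH L h) X)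
iteratedSumH-mulLeft L c x [] X =
  ≈-sym (≈-trans (⊛-congˡ (actC c) (wordOp-vanish L x (λ _ → zeroS) X (λ _ → ≈-refl))) (⊛-zeroʳ (actC c)))
iteratedSumH-mulLeft L c x ((d , w) ∷ h) X = begin
  (actC (c ·C d) ⊛ iteratedSum L (x ++ w) X) ⊕ iteratedSumH L (mulLeft c x h) X
    ≈⟨ ⊕-cong (⊛-cong (actC-·C c d) (wordOp-++ L x w _ X)) (iteratedSumH-mulLeft L c x h X) ⟩
  ((actC c ⊛ actC d) ⊛ Ow) ⊕ (actC c ⊛ Oh)
    ≈⟨ ⊕-congʳ (actC c ⊛ Oh) (≈-trans (⊛-assoc (actC c) (actC d) Ow)
                                      (⊛-congˡ (actC c) (≈-sym (wordOp-⊛ L x (actC d) (iteratedSum L w) X)))) ⟩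
  (actC c ⊛ Odw) ⊕ (actC c ⊛ Oh)
    ≈⟨ ≈-sym (⊛-distribˡ (actC c) Odw Oh) ⟩
  actC c ⊛ (Odw ⊕ Oh)
    ≈⟨ ⊛-congˡ (actC c) (≈-sym (wordOp-⊕ L x (λ Y → actC d ⊛ iteratedSum L w Y) (iteratedSumH L h) X)) ⟩
  actC c ⊛ wordOp L x (iteratedSumH L ((d , w) ∷ h)) X ∎
  where
  open SetoidReasoning (CommutativeRing.setoid seriesCommutativeRing)
  Ow Oh Odw : Series
  Ow  = wordOp L x (iteratedSum L w) X
  Oh  = wordOp L x (iteratedSumH L h) X
  Odw = wordOp L x (λ Y → actC d ⊛ iteratedSum L w Y) X

ħsumAbove-rotaBaxter : ∀ L (f g : ℕ → Series) X →
  ((oneMinusQ ⊛ sumAbove L f X) ⊛ (oneMinusQ ⊛ sumAbove L g X)) ≈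
  ((oneMinusQ ⊛ sumAbove L (λ Y → f Y ⊛ (oneMinusQ ⊛ sumAbove L g Y)) X) ⊕
    ((oneMinusQ ⊛ sumAbove L (λ Y → (oneMinusQ ⊛ sumAbove L f Y) ⊛ g Y) X) ⊕
      (oneMinusQ ⊛ (oneMinusQ ⊛ sumAbove L (λ Y → f Y ⊛ g Y) X))))
ħsumAbove-rotaBaxter L f g X = begin
  (h ⊛ Sf) ⊛ (h ⊛ Sg)
    ≈⟨ solve 3 (λ h Sf Sg → (h :* Sf) :* (h :* Sg) := (h :* h) :* (Sf :* Sg)) ≈-refl h Sf Sg ⟩
  (h ⊛ h) ⊛ (Sf ⊛ Sg)
    ≈⟨ ⊛-congˡ (h ⊛ h) (sumAbove-rotaBaxter L f g X) ⟩
  (h ⊛ h) ⊛ ((R₁ ⊕ R₂) ⊕ R₃)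
    ≈⟨ solve 4 (λ h R₁ R₂ R₃ → (h :* h) :* ((R₁ :+ R₂) :+ R₃) := h :* (h :* R₁) :+ (h :* (h :* R₂) :+ h :* (h :* R₃)))
               ≈-refl h R₁ R₂ R₃ ⟩
  (h ⊛ (h ⊛ R₁)) ⊕ ((h ⊛ (h ⊛ R₂)) ⊕ (h ⊛ (h ⊛ R₃)))
    ≈⟨ ⊕-cong (⊛-congˡ h h⊛R₁) (⊕-congʳ (h ⊛ (h ⊛ R₃)) (⊛-congˡ h h⊛R₂)) ⟩
  (h ⊛ sumAbove L (λ Y → f Y ⊛ (h ⊛ sumAbove L g Y)) X) ⊕
    ((h ⊛ sumAbove L (λ Y → (h ⊛ sumAbove L f Y) ⊛ g Y) X) ⊕ (h ⊛ (h ⊛ R₃))) ∎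
  where
  open SetoidReasoning (CommutativeRing.setoid seriesCommutativeRing)
  open SeriesSolver
  h Sf Sg R₁ R₂ R₃ : Series
  h  = oneMinusQ
  Sf = sumAbove L f X
  Sg = sumAbove L g X
  R₁ = sumAbove L (λ Y → f Y ⊛ sumAbove L g Y) X
  R₂ = sumAbove L (λ Y → sumAbove L f Y ⊛ g Y) X
  R₃ = sumAbove L (λ Y → f Y ⊛ g Y) X
  h⊛R₁ : (h ⊛ R₁) ≈ sumAbove L (λ Y → f Y ⊛ (h ⊛ sumAbove L g Y)) X
  h⊛R₁ = ≈-trans (⊛-distribˡ-sumAbove L h _ X) (sumAbove-cong L X (λ Y → ⊛-left-comm h (f Y) (sumAbove L g Y)))
  h⊛R₂ : (h ⊛ R₂) ≈ sumAbove L (λ Y → (h ⊛ sumAbove L f Y) ⊛ g Y) X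
  h⊛R₂ = ≈-trans (⊛-distribˡ-sumAbove L h _ X) (sumAbove-cong L X (λ Y → ≈-sym (⊛-assoc h (sumAbove L f Y) (g Y))))

p⊕[q⊕-p′]≈q : ∀ {p p' q} → p ≈ p' → (p ⊕ (q ⊕ negS p')) ≈ q
p⊕[q⊕-p′]≈q {p} {p'} {q} p≈p' n =
  trans (cong (λ r → p n + (q n + - r)) (sym (p≈p' n))) (cancel (p n) (q n))
  where
  open +-*-Solver
  cancel : ∀ a b → a + (b + - a) ≡ b
  cancel = solve 2 (λ a b → a :+ (b :+ :- a) := b) refl

p⊕[q⊕-q′]≈p : ∀ {p q q'} → q ≈ q' → (p ⊕ (q ⊕ negS q')) ≈ p
p⊕[q⊕-q′]≈p {p} {q} {q'} q≈q' n =
  trans (cong (λ r → p n + (q n + - r)) (sym (q≈q' n))) (cancel (p n) (q n))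
  where
  open +-*-Solver
  cancel : ∀ a b → a + (b + - b) ≡ a
  cancel = solve 2 (λ a b → a :+ (b :+ :- b) := a) refl

letterOp-⊛ : ∀ L α β (f g : ℕ → Series) X →
  (wordOp L (α ∷ []) f X ⊛ wordOp L (β ∷ []) g X) ≈
  (wordOp L (α ∷ []) (λ Y → f Y ⊛ wordOp L (β ∷ []) g Y) X ⊕
    (wordOp L (β ∷ []) (λ Y → wordOp L (α ∷ []) f Y ⊛ g Y) X ⊕
      (actC (diamondC α β) ⊛ wordOp L (diamondW α β) (λ Y → f Y ⊛ g Y) X)))
letterOp-⊛ L a a f g X =
  ≈-trans (ħsumAbove-rotaBaxter L f g X)
          (⊕-congˡ (oneMinusQ ⊛ sumAbove L (λ Y → f Y ⊛ (oneMinusQ ⊛ sumAbove L g Y)) X)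
            (⊕-congˡ (oneMinusQ ⊛ sumAbove L (λ Y → (oneMinusQ ⊛ sumAbove L f Y) ⊛ g Y) X)
              (⊛-congʳ (oneMinusQ ⊛ sumAbove L (λ Y → f Y ⊛ g Y) X) (≈-sym actC-ħ))))
letterOp-⊛ L a b f g X = ≈-sym (begin
  T₁ ⊕ (T₂ ⊕ (actC (diamondC a b) ⊛ T₃))
    ≈⟨ ⊕-congˡ T₁ (⊕-congˡ T₂ (actC-minusOne-⊛ T₃)) ⟩
  T₁ ⊕ (T₂ ⊕ negS T₃)
    ≈⟨ p⊕[q⊕-p′]≈q (⊛-congˡ oneMinusQ (sumAbove-cong L X (λ Y → ⊛-left-comm (f Y) (y Y) (g Y)))) ⟩
  y X ⊛ ((oneMinusQ ⊛ sumAbove L f X) ⊛ g X)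
    ≈⟨ ⊛-left-comm (y X) (oneMinusQ ⊛ sumAbove L f X) (g X) ⟩
  (oneMinusQ ⊛ sumAbove L f X) ⊛ (y X ⊛ g X) ∎)
  where
  open SetoidReasoning (CommutativeRing.setoid seriesCommutativeRing)
  T₁ T₂ T₃ : Series
  T₁ = oneMinusQ ⊛ sumAbove L (λ Y → f Y ⊛ (y Y ⊛ g Y)) X
  T₂ = y X ⊛ ((oneMinusQ ⊛ sumAbove L f X) ⊛ g X)
  T₃ = oneMinusQ ⊛ sumAbove L (λ Y → y Y ⊛ (f Y ⊛ g Y)) X
letterOp-⊛ L b a f g X = ≈-sym (begin
  T₁ ⊕ (T₂ ⊕ (actC (diamondC b a) ⊛ T₃))
    ≈⟨ ⊕-congˡ T₁ (⊕-congˡ T₂ (actC-minusOne-⊛ T₃)) ⟩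
  T₁ ⊕ (T₂ ⊕ negS T₃)
    ≈⟨ p⊕[q⊕-q′]≈p (⊛-congˡ oneMinusQ (sumAbove-cong L X (λ Y → ⊛-assoc (y Y) (f Y) (g Y)))) ⟩
  y X ⊛ (f X ⊛ (oneMinusQ ⊛ sumAbove L g X))
    ≈⟨ ≈-sym (⊛-assoc (y X) (f X) (oneMinusQ ⊛ sumAbove L g X)) ⟩
  (y X ⊛ f X) ⊛ (oneMinusQ ⊛ sumAbove L g X) ∎)
  where
  open SetoidReasoning (CommutativeRing.setoid seriesCommutativeRing)
  T₁ T₂ T₃ : Series
  T₁ = y X ⊛ (f X ⊛ (oneMinusQ ⊛ sumAbove L g X))
  T₂ = oneMinusQ ⊛ sumAbove L (λ Y → (y Y ⊛ f Y) ⊛ g Y) X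
  T₃ = oneMinusQ ⊛ sumAbove L (λ Y → y Y ⊛ (f Y ⊛ g Y)) X
letterOp-⊛ L b b f g X = ≈-sym (begin
  T₁ ⊕ (T₂ ⊕ (actC (diamondC b b) ⊛ T₃)) ≈⟨ ⊕-congˡ T₁ (⊕-congˡ T₂ (actC-minusOne-⊛ T₃)) ⟩
  T₁ ⊕ (T₂ ⊕ negS T₃)                    ≈⟨ p⊕[q⊕-q′]≈p (⊛-congˡ (y X) (⊛-assoc (y X) (f X) (g X))) ⟩
  y X ⊛ (f X ⊛ (y X ⊛ g X))           ≈⟨ ≈-sym (⊛-assoc (y X) (f X) (y X ⊛ g X)) ⟩
  (y X ⊛ f X) ⊛ (y X ⊛ g X)           ∎)
  where
  open SetoidReasoning (CommutativeRing.setoid seriesCommutativeRing)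
  T₁ T₂ T₃ : Series
  T₁ = y X ⊛ (f X ⊛ (y X ⊛ g X))
  T₂ = y X ⊛ ((y X ⊛ f X) ⊛ g X)
  T₃ = y X ⊛ (y X ⊛ (f X ⊛ g X))

iteratedSumH-single : ∀ L w X → iteratedSumH L ((oneC , w) ∷ []) X ≈ iteratedSum L w X
iteratedSumH-single L w X n =
  trans (ℚP.+-identityʳ _) (trans (⊛-congʳ (iteratedSum L w X) actC-oneC n) (⊛-identityˡ (iteratedSum L w X) n))

iteratedSumH-mulLeft-oneC : ∀ L x h X → iteratedSumH L (mulLeft oneC x h) X ≈ wordOp L x (iteratedSumH L h) X
iteratedSumH-mulLeft-oneC L x h X =
  ≈-trans (iteratedSumH-mulLeft L oneC x h X) (≈-trans (⊛-congʳ O actC-oneC) (⊛-identityˡ O))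
  where
  O : Series
  O = wordOp L x (iteratedSumH L h) X

iteratedSum-∷ : ∀ L α w X → iteratedSum L (α ∷ w) X ≈ wordOp L (α ∷ []) (iteratedSum L w) X
iteratedSum-∷ L a w X = ≈-refl
iteratedSum-∷ L b w X = ≈-refl

iteratedSumH-shuffleW-∷ : ∀ L α β w v X →
  iteratedSumH L (shuffleW (α ∷ w) (β ∷ v)) X ≈
  (wordOp L (α ∷ []) (iteratedSumH L (shuffleW w (β ∷ v))) X ⊕
    (wordOp L (β ∷ []) (iteratedSumH L (shuffleW (α ∷ w) v)) X ⊕
      (actC (diamondC α β) ⊛ wordOp L (diamondW α β) (iteratedSumH L (shuffleW w v)) X)))
iteratedSumH-shuffleW-∷ L α β w v X =
  ≈-trans (sumOver-++ (iteratedSumTerm L X) left (middle ++ right))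
  (≈-trans (⊕-congˡ (iteratedSumH L left X) (sumOver-++ (iteratedSumTerm L X) middle right))
           (⊕-cong (iteratedSumH-mulLeft-oneC L (α ∷ []) (shuffleW w (β ∷ v)) X)
                   (⊕-cong (iteratedSumH-mulLeft-oneC L (β ∷ []) (shuffleW (α ∷ w) v) X)
                           (iteratedSumH-mulLeft L (diamondC α β) (diamondW α β) (shuffleW w v) X))))
  where
  left middle right : H
  left   = mulLeft oneC (α ∷ []) (shuffleW w (β ∷ v))
  middle = mulLeft oneC (β ∷ []) (shuffleW (α ∷ w) v)
  right  = mulLeft (diamondC α β) (diamondW α β) (shuffleW w v)

iteratedSum-shuffleW : ∀ L w v X → (iteratedSum L w X ⊛ iteratedSum L v X) ≈ iteratedSumH L (shuffleW w v) X
iteratedSum-shuffleW L []      v       X = ≈-trans (⊛-identityˡ (iteratedSum L v X)) (≈-sym (iteratedSumH-single L v X))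
iteratedSum-shuffleW L (x ∷ w) []      X =
  ≈-trans (⊛-identityʳ (iteratedSum L (x ∷ w) X)) (≈-sym (iteratedSumH-single L (x ∷ w) X))
iteratedSum-shuffleW L (α ∷ w) (β ∷ v) X = ≈-sym (begin
  iteratedSumH L (shuffleW (α ∷ w) (β ∷ v)) X
    ≈⟨ iteratedSumH-shuffleW-∷ L α β w v X ⟩
  wordOp L (α ∷ []) (iteratedSumH L (shuffleW w (β ∷ v))) X ⊕
    (wordOp L (β ∷ []) (iteratedSumH L (shuffleW (α ∷ w) v)) X ⊕
      (actC (diamondC α β) ⊛ wordOp L (diamondW α β) (iteratedSumH L (shuffleW w v)) X))
    ≈⟨ ⊕-cong (wordOp-cong L (α ∷ []) (λ Y → ≈-trans (≈-sym (iteratedSum-shuffleW L w (β ∷ v) Y))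
                                                     (⊛-congˡ (iteratedSum L w Y) (iteratedSum-∷ L β v Y))) X)
              (⊕-cong (wordOp-cong L (β ∷ []) (λ Y → ≈-trans (≈-sym (iteratedSum-shuffleW L (α ∷ w) v Y))
                                                             (⊛-congʳ (iteratedSum L v Y) (iteratedSum-∷ L α w Y))) X)
                      (⊛-congˡ (actC (diamondC α β))
                               (wordOp-cong L (diamondW α β) (λ Y → ≈-sym (iteratedSum-shuffleW L w v Y)) X))) ⟩
  wordOp L (α ∷ []) (λ Y → iteratedSum L w Y ⊛ wordOp L (β ∷ []) (iteratedSum L v) Y) X ⊕
    (wordOp L (β ∷ []) (λ Y → wordOp L (α ∷ []) (iteratedSum L w) Y ⊛ iteratedSum L v Y) X ⊕
      (actC (diamondC α β) ⊛ wordOp L (diamondW α β) (λ Y → iteratedSum L w Y ⊛ iteratedSum L v Y) X))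
    ≈⟨ ≈-sym (letterOp-⊛ L α β (iteratedSum L w) (iteratedSum L v) X) ⟩
  wordOp L (α ∷ []) (iteratedSum L w) X ⊛ wordOp L (β ∷ []) (iteratedSum L v) X
    ≈⟨ ⊛-cong (≈-sym (iteratedSum-∷ L α w X)) (≈-sym (iteratedSum-∷ L β v X)) ⟩
  iteratedSum L (α ∷ w) X ⊛ iteratedSum L (β ∷ v) X ∎)
  where open SetoidReasoning (CommutativeRing.setoid seriesCommutativeRing)

-- Comparing ζ_q with the iterated sums

data EndsInB : Word → Set where
  [b]  : EndsInB (b ∷ [])
  _∷_ : ∀ x {w} → EndsInB w → EndsInB (x ∷ w)

EmptyOrEndsInB : Word → Set
EmptyOrEndsInB w = w ≡ [] ⊎ EndsInB w

HeadNotB : Word → Set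
HeadNotB []      = ⊤
HeadNotB (a ∷ _) = ⊤
HeadNotB (b ∷ _) = ⊥

EndsInB-tail : ∀ {x w} → EndsInB (x ∷ w) → EmptyOrEndsInB w
EndsInB-tail [b]       = inj₁ refl
EndsInB-tail (_ ∷ w↓b) = inj₂ w↓b

EndsInB-aTail : ∀ {w} → EndsInB (a ∷ w) → EndsInB w
EndsInB-aTail (_ ∷ w↓b) = w↓b

-- firstIndexTerm w M collects the terms of the nested sum for w whose first index m₁ is M
-- (for w = [] the empty product, placed at M = 0).
firstIndexTerm : Word → ℕ → Series
firstIndexTerm []      zero    = oneS
firstIndexTerm []      (suc M) = zeroS
firstIndexTerm (a ∷ w) M       = oneMinusQ ⊛ (y M ⊛ firstIndexTerm w M)
firstIndexTerm (b ∷ w) M       = sumS M (firstIndexTerm w)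

firstIndexTerm-0 : ∀ {w} → EndsInB w → firstIndexTerm w 0 ≈ zeroS
firstIndexTerm-0 [b]           = ≈-refl
firstIndexTerm-0 (a ∷ w↓b)     =
  ≈-trans (⊛-congˡ oneMinusQ (≈-trans (⊛-congˡ (y 0) (firstIndexTerm-0 w↓b)) (⊛-zeroʳ (y 0)))) (⊛-zeroʳ oneMinusQ)
firstIndexTerm-0 (b ∷ _)       = ≈-refl

-- tail-recursive, to follow the accumulator of indicesFrom
ħy-iterate : ℕ → ℕ → Series → Series
ħy-iterate zero    M s = s
ħy-iterate (suc n) M s = ħy-iterate n M (oneMinusQ ⊛ (y M ⊛ s))

ħy-iterate≈powS : ∀ n M s → ħy-iterate n M s ≈ (powS (oneMinusQ ⊛ y M) n ⊛ s)
ħy-iterate≈powS zero    M s = ≈-sym (⊛-identityˡ s)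
ħy-iterate≈powS (suc n) M s = ≈-trans (ħy-iterate≈powS n M (oneMinusQ ⊛ (y M ⊛ s)))
  (solve 4 (λ p h y s → p :* (h :* (y :* s)) := ((h :* y) :* p) :* s) ≈-refl (powS (oneMinusQ ⊛ y M) n) oneMinusQ (y M) s)
  where open SeriesSolver

termS≈powS : ∀ k m → termS k m ≈ powS (oneMinusQ ⊛ y (suc m)) k
termS≈powS zero    m = ≈-trans (⊛-identityˡ _) (⊛-identityˡ oneS)
termS≈powS (suc k) m = begin
  qPow (suc m ℕ.+ k ℕ.* suc m) ⊛ ((h ⊛ hᵏ) ⊛ (g ⊛ gᵏ))
    ≈⟨ ⊛-congʳ ((h ⊛ hᵏ) ⊛ (g ⊛ gᵏ)) (≈-sym (qPow-+ (suc m) (k ℕ.* suc m))) ⟩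
  (q ⊛ qᵏ) ⊛ ((h ⊛ hᵏ) ⊛ (g ⊛ gᵏ))
    ≈⟨ solve 6 (λ q qᵏ h hᵏ g gᵏ → (q :* qᵏ) :* ((h :* hᵏ) :* (g :* gᵏ)) := (h :* (q :* g)) :* (qᵏ :* (hᵏ :* gᵏ)))
               ≈-refl q qᵏ h hᵏ g gᵏ ⟩
  (h ⊛ y (suc m)) ⊛ termS k m
    ≈⟨ ⊛-congˡ (h ⊛ y (suc m)) (termS≈powS k m) ⟩
  (h ⊛ y (suc m)) ⊛ powS (h ⊛ y (suc m)) k ∎
  where
  open SetoidReasoning (CommutativeRing.setoid seriesCommutativeRing)
  open SeriesSolver
  q qᵏ h hᵏ g gᵏ : Series
  q  = qPow (suc m)
  qᵏ = qPow (k ℕ.* suc m)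
  h  = oneMinusQ
  hᵏ = powS oneMinusQ k
  g  = geomS m
  gᵏ = powS (geomS m) k

nestedSum≈sumS-firstIndexTerm : ∀ n w → EmptyOrEndsInB w → (w ≡ [] → n ≡ 0) → ∀ B →
  nestedSum (indicesFrom n w) (suc B) ≈ sumS (suc B) (λ M → ħy-iterate n M (firstIndexTerm w M))
nestedSum≈sumS-firstIndexTerm n [] _ n≡0 B with n≡0 refl
... | refl = ≈-sym (begin
  sumS (suc B) (firstIndexTerm [])  ≈⟨ sumS-sucˡ B (firstIndexTerm []) ⟩
  oneS ⊕ sumS B (λ _ → zeroS)      ≈⟨ ⊕-congˡ oneS (sumS-vanish B (λ _ _ → ≈-refl)) ⟩
  oneS ⊕ zeroS                     ≈⟨ (λ k → ℚP.+-identityʳ (oneS k)) ⟩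
  oneS                             ∎)
  where open SetoidReasoning (CommutativeRing.setoid seriesCommutativeRing)
nestedSum≈sumS-firstIndexTerm n (a ∷ w) (inj₂ aw↓b) _ B =
  nestedSum≈sumS-firstIndexTerm (suc n) w (inj₂ (EndsInB-aTail aw↓b)) (λ { refl → case EndsInB-aTail aw↓b of λ () }) B
nestedSum≈sumS-firstIndexTerm n (b ∷ w) (inj₂ bw↓b) _ B = begin
  nestedSum (n ∷ indicesFrom 0 w) (suc B)
    ≈⟨ sumS-cong B (λ m → ⊛-cong (termS≈powS n m) (nestedSum≈sumS-firstIndexTerm 0 w (EndsInB-tail bw↓b) (λ _ → refl) m)) ⟩
  sumS B (λ m → powS (oneMinusQ ⊛ y (suc m)) n ⊛ sumS (suc m) (firstIndexTerm w))
    ≈⟨ sumS-cong B (λ m → ≈-sym (ħy-iterate≈powS n (suc m) _)) ⟩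
  sumS B (λ m → ħy-iterate n (suc m) (sumS (suc m) (firstIndexTerm w)))
    ≈⟨ ≈-sym (⊕-identityˡ-≈0 (≈-trans (ħy-iterate≈powS n 0 (sumS 0 (firstIndexTerm w)))
                                      (⊛-zeroʳ (powS (oneMinusQ ⊛ y 0) n)))) ⟩
  ħy-iterate n 0 (sumS 0 (firstIndexTerm w)) ⊕ sumS B (λ m → ħy-iterate n (suc m) (sumS (suc m) (firstIndexTerm w)))
    ≈⟨ ≈-sym (sumS-sucˡ B _) ⟩
  sumS (suc B) (λ M → ħy-iterate n M (sumS M (firstIndexTerm w))) ∎
  where
  open SetoidReasoning (CommutativeRing.setoid seriesCommutativeRing)
  ⊕-identityˡ-≈0 : ∀ {f g} → f ≈ zeroS → (f ⊕ g) ≈ g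
  ⊕-identityˡ-≈0 {f} {g} f≈0 k = trans (cong (_+ g k) (f≈0 k)) (ℚP.+-identityˡ (g k))

sumS-sumAbove-⊛ : ∀ B (F G : ℕ → Series) →
  sumS B (λ M' → sumAbove B F M' ⊛ G M') ≈ sumS B (λ M → F M ⊛ sumS M G)
sumS-sumAbove-⊛ B F G = begin
  sumS B (λ M' → sumAbove B F M' ⊛ G M')                    ≈⟨ sumS-cong B (λ M' → ⊛-distribʳ-sumS B _ (G M')) ⟩
  sumS B (λ M' → sumS B (λ M → gate M' M (F M) ⊛ G M'))    ≈⟨ sumS-swap B B (λ M' M → gate M' M (F M) ⊛ G M') ⟩
  sumS B (λ M → sumS B (λ M' → gate M' M (F M) ⊛ G M'))    ≈⟨ sumS-cong-< B (λ M M<B → truncate M (ℕP.<⇒≤ M<B)) ⟩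
  sumS B (λ M → F M ⊛ sumS M G)                            ∎
  where
  open SetoidReasoning (CommutativeRing.setoid seriesCommutativeRing)
  truncate : ∀ M → M ≤ B → sumS B (λ M' → gate M' M (F M) ⊛ G M') ≈ (F M ⊛ sumS M G)
  truncate M M≤B = begin
    sumS B (λ M' → gate M' M (F M) ⊛ G M')
      ≈⟨ (λ k → cong (λ n → sumS n (λ M' → gate M' M (F M) ⊛ G M') k) (sym (ℕP.m+[n∸m]≡n M≤B))) ⟩
    sumS (M ℕ.+ (B ∸ M)) (λ M' → gate M' M (F M) ⊛ G M')
      ≈⟨ sumS-extend M (B ∸ M) _ (λ M' M≤M' → ≈-trans (⊛-congʳ (G M') (gate-≮ (F M) (ℕP.≤⇒≯ M≤M'))) (⊛-zeroˡ (G M'))) ⟩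
    sumS M (λ M' → gate M' M (F M) ⊛ G M')
      ≈⟨ sumS-cong-< M (λ M' M'<M → ⊛-congʳ (G M') (gate-< (F M) M'<M)) ⟩
    sumS M (λ M' → F M ⊛ G M')
      ≈⟨ ≈-sym (⊛-distribˡ-sumS M (F M) G) ⟩
    F M ⊛ sumS M G ∎

sumAbove-sumS : ∀ L B (F : ℕ → ℕ → Series) X →
  sumAbove L (λ Y → sumS B (F Y)) X ≈ sumS B (λ M → sumAbove L (λ Y → F Y M) X)
sumAbove-sumS L B F X = ≈-trans (sumS-cong L (λ Y → gate-sumS X Y B (F Y))) (sumS-swap L B (λ Y M → gate X Y (F Y M)))

sumS-qPow⊛firstIndexTerm-[] : ∀ P {B} → 0 < B → sumS B (λ M → qPow (P ℕ.* M) ⊛ firstIndexTerm [] M) ≈ oneS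
sumS-qPow⊛firstIndexTerm-[] P {suc B} _ = begin
  sumS (suc B) (λ M → qPow (P ℕ.* M) ⊛ firstIndexTerm [] M)
    ≈⟨ sumS-sucˡ B _ ⟩
  (qPow (P ℕ.* 0) ⊛ oneS) ⊕ sumS B (λ M → qPow (P ℕ.* suc M) ⊛ zeroS)
    ≈⟨ ⊕-cong (⊛-identityʳ (qPow (P ℕ.* 0))) (sumS-vanish B (λ M _ → ⊛-zeroʳ (qPow (P ℕ.* suc M)))) ⟩
  qPow (P ℕ.* 0) ⊕ zeroS
    ≈⟨ (λ k → trans (ℚP.+-identityʳ _) (cong (λ e → qPow e k) (ℕP.*-zeroʳ P))) ⟩
  oneS ∎
  where open SetoidReasoning (CommutativeRing.setoid seriesCommutativeRing)

module _ {N L B : ℕ} (N<L : N < L) (N<B : N < B) where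
  open SetoidReasoning (truncatedSetoid N)

  sumAbove-qPow⊛firstIndexTerm : ∀ P {w} → EndsInB w → ∀ M →
    (sumAbove L (λ Y → qPow (Y ℕ.* M)) P ⊛ firstIndexTerm w M) ≈[ N ] ((qPow (P ℕ.* M) ⊛ y M) ⊛ firstIndexTerm w M)
  sumAbove-qPow⊛firstIndexTerm P {w} w↓b zero =
    ≈⇒≈[] N (≈-trans (vanish (sumAbove L (λ Y → qPow (Y ℕ.* 0)) P)) (≈-sym (vanish (qPow (P ℕ.* 0) ⊛ y 0))))
    where
    vanish : ∀ f → (f ⊛ firstIndexTerm w 0) ≈ zeroS
    vanish f = ≈-trans (⊛-congˡ f (firstIndexTerm-0 w↓b)) (⊛-zeroʳ f)
  sumAbove-qPow⊛firstIndexTerm P {w} _ (suc m) = ⊛-congʳ[] (firstIndexTerm w (suc m)) (begin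
    sumAbove L (λ Y → qPow (Y ℕ.* suc m)) P ≈⟨ ≈⇒≈[] N (sumAbove-cong L P (λ Y k → cong (λ e → qPow e k) (ℕP.*-comm Y (suc m)))) ⟩
    sumAbove L (λ Y → qPow (suc m ℕ.* Y)) P ≈⟨ ≈[]-sym (qPow⊛y≈[]sumAbove m P N L N<L) ⟩
    qPow (suc m ℕ.* P) ⊛ y (suc m)          ≈⟨ ≈⇒≈[] N (⊛-congʳ (y (suc m)) (λ k → cong (λ e → qPow e k) (ℕP.*-comm (suc m) P))) ⟩
    qPow (P ℕ.* suc m) ⊛ y (suc m)          ∎)

  -- P ≥ 1 is needed for the letter b, as y 0 is junk.
  iteratedSum≈[]sumS-firstIndexTerm : ∀ w P → EmptyOrEndsInB w → 1 ≤ P ⊎ HeadNotB w →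
    iteratedSum L w P ≈[ N ] sumS B (λ M → qPow (P ℕ.* M) ⊛ firstIndexTerm w M)
  iteratedSum≈[]sumS-firstIndexTerm [] P _ _ =
    ≈⇒≈[] N (≈-sym (sumS-qPow⊛firstIndexTerm-[] P (ℕP.≤-trans (s≤s z≤n) N<B)))
  iteratedSum≈[]sumS-firstIndexTerm (b ∷ w) zero    _            (inj₁ ())
  iteratedSum≈[]sumS-firstIndexTerm (b ∷ w) zero    _            (inj₂ ())
  iteratedSum≈[]sumS-firstIndexTerm (b ∷ w) (suc p) (inj₂ bw↓b) _ = begin
    y P ⊛ iteratedSum L w P
      ≈⟨ ⊛-congˡ[] (y P) (iteratedSum≈[]sumS-firstIndexTerm w P (EndsInB-tail bw↓b) (inj₁ (s≤s z≤n))) ⟩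
    y P ⊛ sumS B (λ M' → qPow (P ℕ.* M') ⊛ E M')
      ≈⟨ ≈⇒≈[] N (≈-trans (⊛-distribˡ-sumS B (y P) (λ M' → qPow (P ℕ.* M') ⊛ E M'))
                           (sumS-cong B (λ M' → ⊛-left-comm (y P) (qPow (P ℕ.* M')) (E M')))) ⟩
    sumS B (λ M' → qPow (P ℕ.* M') ⊛ (y P ⊛ E M'))
      ≈⟨ ≈⇒≈[] N (sumS-cong B (λ M' → ≈-sym (⊛-assoc (qPow (P ℕ.* M')) (y P) (E M')))) ⟩
    sumS B (λ M' → (qPow (P ℕ.* M') ⊛ y P) ⊛ E M')
      ≈⟨ sumS-cong[] B (λ M' _ → ⊛-congʳ[] (E M') (qPow⊛y≈[]sumAbove p M' N B N<B)) ⟩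
    sumS B (λ M' → sumAbove B (λ M → qPow (P ℕ.* M)) M' ⊛ E M')
      ≈⟨ ≈⇒≈[] N (sumS-sumAbove-⊛ B (λ M → qPow (P ℕ.* M)) E) ⟩
    sumS B (λ M → qPow (P ℕ.* M) ⊛ sumS M E) ∎
    where
    P : ℕ
    P = suc p
    E : ℕ → Series
    E = firstIndexTerm w
  iteratedSum≈[]sumS-firstIndexTerm (a ∷ w) P (inj₂ aw↓b) _ = begin
    h ⊛ sumAbove L (iteratedSum L w) P
      ≈⟨ ⊛-congˡ[] h (sumS-cong[] L (λ Y _ → gate-cong[] P Y N (λ P<Y →
           iteratedSum≈[]sumS-firstIndexTerm w Y (inj₂ w↓b) (inj₁ (ℕP.≤-trans (s≤s z≤n) P<Y))))) ⟩
    h ⊛ sumAbove L (λ Y → sumS B (λ M → qPow (Y ℕ.* M) ⊛ E M)) P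
      ≈⟨ ≈⇒≈[] N (⊛-congˡ h (≈-trans (sumAbove-sumS L B _ P)
                               (sumS-cong B (λ M → ≈-sym (⊛-distribʳ-sumAbove L (E M) (λ Y → qPow (Y ℕ.* M)) P))))) ⟩
    h ⊛ sumS B (λ M → sumAbove L (λ Y → qPow (Y ℕ.* M)) P ⊛ E M)
      ≈⟨ ⊛-congˡ[] h (sumS-cong[] B (λ M _ → sumAbove-qPow⊛firstIndexTerm P w↓b M)) ⟩
    h ⊛ sumS B (λ M → (qPow (P ℕ.* M) ⊛ y M) ⊛ E M)
      ≈⟨ ≈⇒≈[] N (≈-trans (⊛-distribˡ-sumS B h (λ M → (qPow (P ℕ.* M) ⊛ y M) ⊛ E M)) (sumS-cong B (λ M →
           solve 4 (λ h q y e → h :* ((q :* y) :* e) := q :* (h :* (y :* e))) ≈-refl h (qPow (P ℕ.* M)) (y M) (E M)))) ⟩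
    sumS B (λ M → qPow (P ℕ.* M) ⊛ (h ⊛ (y M ⊛ E M))) ∎
    where
    open SeriesSolver
    h : Series
    h = oneMinusQ
    E : ℕ → Series
    E = firstIndexTerm w
    w↓b : EndsInB w
    w↓b = EndsInB-aTail aw↓b

-- The coefficient of q^i only needs the truncation levels N = i and B = i + 1.
ζqWord≈[]iteratedSum : ∀ N w → EmptyOrEndsInB w → HeadNotB w → ζqWord w ≈[ N ] iteratedSum (suc N) w 0
ζqWord≈[]iteratedSum N w w↓b w↛b i i≤N = begin
  nestedSum (indices w) (suc i) i
    ≡⟨ nestedSum≈sumS-firstIndexTerm 0 w w↓b (λ _ → refl) i i ⟩
  sumS (suc i) (firstIndexTerm w) i
    ≡⟨ sumS-cong (suc i) (λ M → ≈-sym (⊛-identityˡ (firstIndexTerm w M))) i ⟩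
  sumS (suc i) (λ M → qPow (0 ℕ.* M) ⊛ firstIndexTerm w M) i
    ≡⟨ sym (iteratedSum≈[]sumS-firstIndexTerm (s≤s i≤N) (ℕP.n<1+n i) w 0 w↓b (inj₂ w↛b) i ℕP.≤-refl) ⟩
  iteratedSum (suc N) w 0 i ∎
  where open ≡-Reasoning

-- Ĥ⁰ is closed under the q-shuffle

Admissible : Word → Set
Admissible w = EmptyOrEndsInB w × HeadNotB w

AllAdmissible : H → Set
AllAdmissible = All (Admissible ∘ proj₂)

EndsInB-++-[b] : ∀ v → EndsInB (v ++ [ b ])
EndsInB-++-[b] []      = [b]
EndsInB-++-[b] (x ∷ v) = x ∷ EndsInB-++-[b] v

EndsInB-++ˡ : ∀ x {u} → EndsInB u → EndsInB (x ++ u)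
EndsInB-++ˡ []      u↓b = u↓b
EndsInB-++ˡ (l ∷ x) u↓b = l ∷ EndsInB-++ˡ x u↓b

WordInH0⇒Admissible : ∀ {w} → WordInH0 w → Admissible w
WordInH0⇒Admissible (inj₁ refl)       = inj₁ refl , tt
WordInH0⇒Admissible (inj₂ (v , refl)) = inj₂ (a ∷ EndsInB-++-[b] v) , tt

All-mulLeft : ∀ {P Q : Word → Set} c x h → (∀ {w} → P w → Q (x ++ w)) →
  All (P ∘ proj₂) h → All (Q ∘ proj₂) (mulLeft c x h)
All-mulLeft c x h P⇒Q = map⁺ ∘ All.map P⇒Q

shuffleW-EndsInB : ∀ w v → EmptyOrEndsInB w → EmptyOrEndsInB v → EndsInB w ⊎ EndsInB v →
  All (EndsInB ∘ proj₂) (shuffleW w v)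
shuffleW-EndsInB []      v       _ _ (inj₂ v↓b) = v↓b ∷ []
shuffleW-EndsInB (x ∷ w) []      _ _ (inj₁ w↓b) = w↓b ∷ []
shuffleW-EndsInB (α ∷ w) (β ∷ v) (inj₂ αw↓b) (inj₂ βv↓b) _ =
  ++⁺ (All-mulLeft oneC (α ∷ []) (shuffleW w (β ∷ v)) (α ∷_)
         (shuffleW-EndsInB w (β ∷ v) (EndsInB-tail αw↓b) (inj₂ βv↓b) (inj₂ βv↓b)))
  (++⁺ (All-mulLeft oneC (β ∷ []) (shuffleW (α ∷ w) v) (β ∷_)
          (shuffleW-EndsInB (α ∷ w) v (inj₂ αw↓b) (EndsInB-tail βv↓b) (inj₁ αw↓b)))
       (diamond αw↓b βv↓b))
  where
  diamond : ∀ {α β w v} → EndsInB (α ∷ w) → EndsInB (β ∷ v) →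
    All (EndsInB ∘ proj₂) (mulLeft (diamondC α β) (diamondW α β) (shuffleW w v))
  diamond [b]                   [b]       = (b ∷ [b]) ∷ []
  diamond {α} {β} {w} {v} (_ ∷ w↓b) βv↓b  =
    All-mulLeft (diamondC α β) (diamondW α β) _ (EndsInB-++ˡ (diamondW α β))
      (shuffleW-EndsInB w v (inj₂ w↓b) (EndsInB-tail βv↓b) (inj₁ w↓b))
  diamond {α} {β} {w} {v} [b] (_ ∷ v↓b) =
    All-mulLeft (diamondC α β) (diamondW α β) _ (EndsInB-++ˡ (diamondW α β))
      (shuffleW-EndsInB [] v (inj₁ refl) (inj₂ v↓b) (inj₂ v↓b))

shuffleW-HeadNotB : ∀ w v → HeadNotB w → HeadNotB v → All (HeadNotB ∘ proj₂) (shuffleW w v)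
shuffleW-HeadNotB []      v       _ v↛b = v↛b ∷ []
shuffleW-HeadNotB (x ∷ w) []      w↛b _ = w↛b ∷ []
shuffleW-HeadNotB (a ∷ w) (a ∷ v) _ _   =
  ++⁺ (startsWithA oneC (shuffleW w (a ∷ v)))
      (++⁺ (startsWithA oneC (shuffleW (a ∷ w) v)) (startsWithA (diamondC a a) (shuffleW w v)))
  where
  startsWithA : ∀ c h → All (HeadNotB ∘ proj₂) (mulLeft c (a ∷ []) h)
  startsWithA c h = map⁺ (All.universal (λ _ → tt) h)

shuffleW-Admissible : ∀ w v → Admissible w → Admissible v → AllAdmissible (shuffleW w v)
shuffleW-Admissible w v (w↓b , w↛b) (v↓b , v↛b) = All.zip (emptyOrEndsInB w v w↓b v↓b , shuffleW-HeadNotB w v w↛b v↛b)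
  where
  emptyOrEndsInB : ∀ w v → EmptyOrEndsInB w → EmptyOrEndsInB v → All (EmptyOrEndsInB ∘ proj₂) (shuffleW w v)
  emptyOrEndsInB []      v       _          v↓b = v↓b ∷ []
  emptyOrEndsInB (x ∷ w) []      w↓b        _   = w↓b ∷ []
  emptyOrEndsInB (α ∷ w) (β ∷ v) (inj₂ αw↓b) v↓b =
    All.map inj₂ (shuffleW-EndsInB (α ∷ w) (β ∷ v) (inj₂ αw↓b) v↓b (inj₁ αw↓b))

shuffleq-Admissible : ∀ h k → InH0 h → InH0 k → AllAdmissible (shuffleq h k)
shuffleq-Admissible h k h∈H0 k∈H0 =
  concat⁺ (map⁺ (All.map (λ {t} t∈H0 → concat⁺ (map⁺ (All.map (λ {s} s∈H0 →
    map⁺ (shuffleW-Admissible (proj₂ t) (proj₂ s) (WordInH0⇒Admissible t∈H0) (WordInH0⇒Admissible s∈H0))) k∈H0))) h∈H0))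

sumOver-cong : ∀ {A : Set} {F G : A → Series} l → (∀ t → F t ≈ G t) → sumOver F l ≈ sumOver G l
sumOver-cong []      F≈G = ≈-refl
sumOver-cong (t ∷ l) F≈G = ⊕-cong (F≈G t) (sumOver-cong l F≈G)

⊛-distribʳ-sumOver : ∀ {A : Set} (F : A → Series) l g → (sumOver F l ⊛ g) ≈ sumOver (λ t → F t ⊛ g) l
⊛-distribʳ-sumOver F []      g = ⊛-zeroˡ g
⊛-distribʳ-sumOver F (t ∷ l) g = ≈-trans (⊛-distribʳ g (F t) (sumOver F l)) (⊕-congˡ (F t ⊛ g) (⊛-distribʳ-sumOver F l g))

⊛-distribˡ-sumOver : ∀ {A : Set} (F : A → Series) l g → (g ⊛ sumOver F l) ≈ sumOver (λ t → g ⊛ F t) l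
⊛-distribˡ-sumOver F l g =
  ≈-trans (⊛-comm g (sumOver F l)) (≈-trans (⊛-distribʳ-sumOver F l g) (sumOver-cong l (λ t → ⊛-comm (F t) g)))

sumOver-concatMap : ∀ {A B : Set} (F : B → Series) (f : A → List B) l → sumOver F (concatMap f l) ≈ sumOver (sumOver F ∘ f) l
sumOver-concatMap F f []      = ≈-refl
sumOver-concatMap F f (t ∷ l) =
  ≈-trans (sumOver-++ F (f t) (concatMap f l)) (⊕-congˡ (sumOver F (f t)) (sumOver-concatMap F f l))

iteratedSumH-map : ∀ L X c (m : C × Word → C × Word) h → (∀ t → proj₂ (m t) ≡ proj₂ t) →
  (∀ t → actC (proj₁ (m t)) ≈ (actC c ⊛ actC (proj₁ t))) → iteratedSumH L (map m h) X ≈ (actC c ⊛ iteratedSumH L h X)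
iteratedSumH-map L X c m []      _      _       = ≈-sym (⊛-zeroʳ (actC c))
iteratedSumH-map L X c m (t ∷ h) sameW actC-m =
  ≈-trans (⊕-cong (≈-trans (⊛-cong (actC-m t) (λ k → cong (λ w → iteratedSum L w X k) (sameW t)))
                           (⊛-assoc (actC c) (actC (proj₁ t)) (iteratedSum L (proj₂ t) X)))
                  (iteratedSumH-map L X c m h sameW actC-m))
          (≈-sym (⊛-distribˡ (actC c) (iteratedSumTerm L X t) (iteratedSumH L h X)))

iteratedSumH-concatMap-shuffle : ∀ L X c w k (g : C × Word → H) →
  (∀ s → iteratedSumH L (g s) X ≈ (actC (c ·C proj₁ s) ⊛ iteratedSumH L (shuffleW w (proj₂ s)) X)) →
  iteratedSumH L (concatMap g k) X ≈ (iteratedSumTerm L X (c , w) ⊛ iteratedSumH L k X)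
iteratedSumH-concatMap-shuffle L X c w k g g≈ = begin
  iteratedSumH L (concatMap g k) X
    ≈⟨ sumOver-concatMap (iteratedSumTerm L X) g k ⟩
  sumOver (λ s → iteratedSumH L (g s) X) k
    ≈⟨ sumOver-cong k (λ s → ≈-trans (g≈ s) (⊛-cong (actC-·C c (proj₁ s)) (≈-sym (iteratedSum-shuffleW L w (proj₂ s) X)))) ⟩
  sumOver (λ s → (actC c ⊛ actC (proj₁ s)) ⊛ (iteratedSum L w X ⊛ iteratedSum L (proj₂ s) X)) k
    ≈⟨ sumOver-cong k (λ s → solve 4 (λ a b c d → (a :* b) :* (c :* d) := (a :* c) :* (b :* d)) ≈-refl
                                      (actC c) (actC (proj₁ s)) (iteratedSum L w X) (iteratedSum L (proj₂ s) X)) ⟩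
  sumOver (λ s → iteratedSumTerm L X (c , w) ⊛ iteratedSumTerm L X s) k
    ≈⟨ ≈-sym (⊛-distribˡ-sumOver (iteratedSumTerm L X) k (iteratedSumTerm L X (c , w))) ⟩
  iteratedSumTerm L X (c , w) ⊛ iteratedSumH L k X ∎
  where
  open SetoidReasoning (CommutativeRing.setoid seriesCommutativeRing)
  open SeriesSolver

iteratedSumH-shuffleq : ∀ L h k X → iteratedSumH L (shuffleq h k) X ≈ (iteratedSumH L h X ⊛ iteratedSumH L k X)
iteratedSumH-shuffleq L h k X = begin
  iteratedSumH L (shuffleq h k) X
    ≈⟨ sumOver-concatMap (iteratedSumTerm L X) _ h ⟩
  sumOver _ h
    ≈⟨ sumOver-cong h (λ t → iteratedSumH-concatMap-shuffle L X (proj₁ t) (proj₂ t) k _ (λ s →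
         iteratedSumH-map L X (proj₁ t ·C proj₁ s) _ (shuffleW (proj₂ t) (proj₂ s)) (λ _ → refl)
                          (λ r → actC-·C (proj₁ t ·C proj₁ s) (proj₁ r)))) ⟩
  sumOver (λ t → iteratedSumTerm L X t ⊛ iteratedSumH L k X) h
    ≈⟨ ≈-sym (⊛-distribʳ-sumOver (iteratedSumTerm L X) h (iteratedSumH L k X)) ⟩
  iteratedSumH L h X ⊛ iteratedSumH L k X ∎
  where open SetoidReasoning (CommutativeRing.setoid seriesCommutativeRing)

ζq≈[]iteratedSumH : ∀ N h → AllAdmissible h → ζq h ≈[ N ] iteratedSumH (suc N) h 0
ζq≈[]iteratedSumH N []            []                    = λ _ _ → refl
ζq≈[]iteratedSumH N ((c , w) ∷ h) ((w↓b , w↛b) ∷ h-adm) =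
  ⊕-cong[] (⊛-congˡ[] (actC c) (ζqWord≈[]iteratedSum N w w↓b w↛b)) (ζq≈[]iteratedSumH N h h-adm)

corollary3p19 : (w u : H) → InH0 w → InH0 u →
                (N : ℕ) → (ζq w ⊛ ζq u) N ≡ ζq (shuffleq w u) N
corollary3p19 w u w∈H0 u∈H0 N = begin
  (ζq w ⊛ ζq u) N
    ≡⟨ ⊛-cong[] (ζq≈[]iteratedSumH N w (admissible w∈H0)) (ζq≈[]iteratedSumH N u (admissible u∈H0)) N ℕP.≤-refl ⟩
  (iteratedSumH (suc N) w 0 ⊛ iteratedSumH (suc N) u 0) N
    ≡⟨ sym (iteratedSumH-shuffleq (suc N) w u 0 N) ⟩
  iteratedSumH (suc N) (shuffleq w u) 0 N
    ≡⟨ sym (ζq≈[]iteratedSumH N (shuffleq w u) (shuffleq-Admissible w u w∈H0 u∈H0) N ℕP.≤-refl) ⟩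
  ζq (shuffleq w u) N ∎
  where
  open ≡-Reasoning
  admissible : ∀ {h} → InH0 h → AllAdmissible h
  admissible = All.map WordInH0⇒Admissible
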